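{- Let $q$ be a prime power with $q\equiv 1\pmod 3$ and let $n\geq 2$ be an integer. Let $\omega\in\mathbb{F}_{q^{2n}}\setminus\mathbb{F}_{q^n}$, let $a\in\mathbb{F}_{q^{3n}}^*$ and let $i$ be an integer with $1\leq i\leq 3n-1$ such that (I) $\gcd(i,2n)=\gcd(i,3n)=1$, and (II) $\big(N_{q^{3n}/q}(a)\big)^{\frac{q-1}{3}}\neq 1$. Then $$L_U=\{\langle ax^{q^i}+x\omega\rangle_{\mathbb{F}_{q^{2n}}} : x\in\mathbb{F}_{q^{3n}}^*\},\qquad U=\{ax^{q^i}+x\omega: x\in\mathbb{F}_{q^{3n}}\},$$ is a scattered $\mathbb{F}_q$-linear set of rank $3n$ of the projective plane $PG(2,q^{2n})=PG(\mathbb{F}_{q^{6n}},\mathbb{F}_{q^{2n}})$.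
   Context: $N_{q^{3n}/q}$ denotes the norm map from $\mathbb{F}_{q^{3n}}$ to $\mathbb{F}_{q}$. $\mathbb{F}_{q^{6n}}$ is regarded as a $3$-dimensional vector space over $\mathbb{F}_{q^{2n}}$. For an $\mathbb{F}_q$-subspace $U$ of $\mathbb{F}_{q^{6n}}$ of $\mathbb{F}_q$-dimension $k$, $L_U=\{\langle u\rangle_{\mathbb{F}_{q^{2n}}}: u\in U\setminus\{0\}\}$ is an $\mathbb{F}_q$-linear set of rank $k$; it is scattered if every point $\langle v\rangle$ of $L_U$ satisfies $\dim_{\mathbb{F}_q}(U\cap\langle v\rangle_{\mathbb{F}_{q^{2n}}})=1$. -}

module Defs where

open import Level using (Level)
open import Data.Nat as ℕ using (ℕ; zero; suc)
open import Data.Fin using (Fin)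
open import Data.Product using (Σ; ∃; _×_; _,_)
open import Relation.Nullary using (¬_)
open import Relation.Binary.PropositionalEquality as ≡ using (_≡_)
open import Function.Bundles using (Bijection)
open import Algebra.Bundles using (CommutativeRing)
import Algebra.Definitions.RawSemiring as RS

IsField : ∀ {c ℓ} → CommutativeRing c ℓ → Set (c Level.⊔ ℓ)
IsField R = (1# ≉ 0#) × (∀ x → x ≉ 0# → ∃ λ y → x * y ≈ 1#)
  where open CommutativeRing R

HasSize : ∀ {c ℓ} → CommutativeRing c ℓ → ℕ → Set (c Level.⊔ ℓ)
HasSize R N = Bijection (CommutativeRing.setoid R) (≡.setoid (Fin N))

IsPrimePower : ℕ → Set
IsPrimePower q = Σ ℕ λ p → Σ ℕ λ k → Prime' p × (q ≡ p ℕ.^ suc k)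
  where open import Data.Nat.Primality renaming (Prime to Prime')

module FieldNotions {c ℓ} (R : CommutativeRing c ℓ) (q : ℕ) where
  open CommutativeRing R
  open import Algebra.Bundles using (Semiring)
  open RS (Semiring.rawSemiring semiring) public using (_^_)

  -- x lies in the subfield F_{q^m} = { x : x^{q^m} = x }
  InSub : ℕ → Carrier → Set ℓ
  InSub m x = x ^ (q ℕ.^ m) ≈ x

  normProd : ℕ → Carrier → Carrier
  normProd zero    a = 1#
  normProd (suc j) a = normProd j a * (a ^ (q ℕ.^ j))

  Norm : ℕ → Carrier → Carrier
  Norm m a = normProd m a

  -- U is scattered: for every nonzero v ∈ U, U ∩ ⟨v⟩_{F_{q^e}} is the
  -- 1-dimensional F_q-space ⟨v⟩_{F_q}, i.e. every w ∈ U that is an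
  -- F_{q^e}-multiple of v is an F_q-multiple of v.
  Scattered : ∀ {u} → ℕ → (Carrier → Set u) → Set (c Level.⊔ ℓ Level.⊔ u)
  Scattered e U =
    ∀ v → U v → v ≉ 0# →
    ∀ w → U w → (∃ λ λ' → InSub e λ' × w ≈ λ' * v) →
    ∃ λ μ → InSub 1 μ × w ≈ μ * v

{-# OPTIONS --safe #-}
-- Write σ x = x^{q^i} and T x = a σ(x), so that f x = T x + x ω, and ū = u^{q^n},
-- the conjugation of 𝔽_{q^{2n}} over 𝔽_{q^n}.  As |F| = q^{6n}, x ↦ x^q is
-- additive, so T is σ-semilinear.
--
-- Injectivity: f x = f y with x ≠ y puts ω = -T(x-y)/(x-y) in
-- 𝔽_{q^{3n}} ∩ 𝔽_{q^{2n}} = 𝔽_{q^n}.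
--
-- Scatteredness: let f y = λ f x with λ ∈ 𝔽_{q^{2n}}.  Raising to the q^{3n}-th
-- power gives T y + y ω̄ = λ̄ (T x + x ω̄).  If λ = λ̄, the two equations give
-- y = λ x and T y = λ T x, so λ^σ = λ and λ ∈ 𝔽_{q^i} ∩ 𝔽_{q^n} = 𝔽_q.
-- Otherwise they express y and T y over 𝔽_{q^n} in x and T x, and applying T
-- to the first yields T² x = P T x + R x with P, R ∈ 𝔽_{q^n}, R ≠ 0.  On
-- 𝔽_{q^{3n}}, T^{3n} is multiplication by A = a a^σ ⋯ a^{σ^{3n-1}} ∈ 𝔽_q^*,
-- and A = N_{q^{3n}/q}(a) since j ↦ i j permutes ℤ/3n.  If T x = κ x with
-- κ ∈ 𝔽_{q^n}, then A is the cube of κ κ^σ ⋯ κ^{σ^{n-1}} ∈ 𝔽_q^*.  Otherwise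
-- x and T x are 𝔽_{q^n}-independent, and writing T^k x = e_k x + g_k T x, the
-- Casoratian e_k g_{k+1} - e_{k+1} g_k is the analogous product of -R's,
-- which at k = 3n is both A² and a cube C³ with C ∈ 𝔽_q^*, so A = (A/C)³.
-- Either way N(a)^{(q-1)/3} = 1, contradicting (II).

module Submission where

open import Defs
open import Level using (_⊔_)
open import Algebra.Bundles using (CommutativeRing; CommutativeSemiring; CommutativeMonoid)
open import Data.Empty using (⊥-elim)
open import Data.Fin as Fin using (Fin; toℕ; inject₁; fromℕ)
import Data.Fin.Properties as Fin
open import Data.Nat as ℕ using (ℕ; zero; suc; NonZero; z≤n; s≤s; _≤_; _∸_; _/_; _%_; _!; nonTrivial⇒≢1)
import Data.Nat.Properties as ℕ
open import Data.Nat.Combinatorics using (_C_; nCk≡n!/k![n-k]!; k![n∸k]!∣n!; nCn≡1)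
open import Data.Nat.Divisibility using (_∣_; divides; ∣-trans; n∣m*n; ∣⇒≤; ∣1⇒≡1; m∣m*n)
open import Data.Nat.DivMod
  using (m/n*n≡m; m*n/n≡m; m≡m%n+[m/n]*n; %-congˡ; [m+n]%n≡m%n; [m+kn]%n≡m%n; m%n<n; %-distribˡ-*; m%n%n≡m%n; m<n⇒m%n≡m)
open import Data.Nat.GCD using (gcd; gcd-GCD; module Bézout; gcd-greatest; gcd[m,n]∣m; gcd[m,n]∣n)
open import Data.Nat.Primality using (Prime; euclidsLemma; prime⇒nonTrivial; prime⇒nonZero)
open import Data.Nat.Solver using (module +-*-Solver)
open import Data.Product using (∃; _×_; _,_; proj₁; proj₂)
open import Data.Sum using (inj₁; inj₂)
open import Relation.Nullary using (¬_; Dec; yes; no)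
open import Relation.Binary.PropositionalEquality using (_≡_)
import Relation.Binary.PropositionalEquality as ≡

prime∤! : ∀ {p} m → Prime p → m ℕ.< p → ¬ (p ∣ m !)
prime∤! zero    p-prime _   p∣1  = nonTrivial⇒≢1 {{prime⇒nonTrivial p-prime}} (∣1⇒≡1 p∣1)
prime∤! (suc m) p-prime m<p p∣m! with euclidsLemma (suc m) (m !) p-prime p∣m!
... | inj₁ p∣1+m = ℕ.<⇒≱ m<p (∣⇒≤ p∣1+m)
... | inj₂ p∣m!  = prime∤! m p-prime (ℕ.<-trans (ℕ.n<1+n m) m<p) p∣m!

nCk*k!*[n∸k]!≡n! : ∀ {n k} → k ≤ n → (n C k) ℕ.* (k ! ℕ.* (n ∸ k) !) ≡ n !
nCk*k!*[n∸k]!≡n! {n} {k} k≤n = begin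
  (n C k) ℕ.* (k ! ℕ.* (n ∸ k) !)                ≡⟨ ≡.cong (ℕ._* (k ! ℕ.* (n ∸ k) !)) (nCk≡n!/k![n-k]! k≤n) ⟩
  n ! / (k ! ℕ.* (n ∸ k) !) ℕ.* (k ! ℕ.* (n ∸ k) !) ≡⟨ m/n*n≡m (k![n∸k]!∣n! k≤n) ⟩
  n !                                            ∎
  where
  open ≡.≡-Reasoning
  instance
    k![n∸k]!≢0 : NonZero (k ! ℕ.* (n ∸ k) !)
    k![n∸k]!≢0 = ℕ._!*_!≢0 k (n ∸ k)

prime∣choose : ∀ {p k} → Prime p → 0 ℕ.< k → k ℕ.< p → p ∣ p C k
prime∣choose {p} {k} p-prime 0<k k<p
  with euclidsLemma (p C k) (k ! ℕ.* (p ∸ k) !) p-prime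
         (≡.subst (p ∣_) (≡.sym (nCk*k!*[n∸k]!≡n! (ℕ.<⇒≤ k<p))) (n∣n! p-prime))
  where
  n∣n! : ∀ {n} → Prime n → n ∣ n !
  n∣n! {suc n} _ = m∣m*n (n !)
... | inj₁ p∣pCk = p∣pCk
... | inj₂ p∣k![p∸k]! with euclidsLemma (k !) ((p ∸ k) !) p-prime p∣k![p∸k]!
...   | inj₁ p∣k!      = ⊥-elim (prime∤! k p-prime k<p p∣k!)
...   | inj₂ p∣[p∸k]!  = ⊥-elim (prime∤! (p ∸ k) p-prime (ℕ.∸-monoʳ-< 0<k (ℕ.<⇒≤ k<p)) p∣[p∸k]!)

IsPrimePower⇒NonZero : ∀ {q} → IsPrimePower q → NonZero q
IsPrimePower⇒NonZero (p , k , p-prime , ≡.refl) = ℕ.m^n≢0 p (suc k) {{prime⇒nonZero p-prime}}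

gcd[m,kn]≡1⇒gcd[m,n]≡1 : ∀ m k n → gcd m (k ℕ.* n) ≡ 1 → gcd m n ≡ 1
gcd[m,kn]≡1⇒gcd[m,n]≡1 m k n gcd≡1 = ∣1⇒≡1 (≡.subst (gcd m n ∣_) gcd≡1
  (gcd-greatest (gcd[m,n]∣m m n) (∣-trans (gcd[m,n]∣n m n) (n∣m*n k))))

q%3≡1⇒3*[q∸1]/3≡q∸1 : ∀ {q} → q % 3 ≡ 1 → 3 ℕ.* ((q ∸ 1) / 3) ≡ q ∸ 1
q%3≡1⇒3*[q∸1]/3≡q∸1 {q} q%3≡1 = begin
  3 ℕ.* ((q ∸ 1) / 3)     ≡⟨ ℕ.*-comm 3 ((q ∸ 1) / 3) ⟩
  (q ∸ 1) / 3 ℕ.* 3       ≡⟨ ≡.cong (λ t → t / 3 ℕ.* 3) q∸1≡q/3*3 ⟩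
  q / 3 ℕ.* 3 / 3 ℕ.* 3   ≡⟨ ≡.cong (ℕ._* 3) (m*n/n≡m (q / 3) 3) ⟩
  q / 3 ℕ.* 3             ≡⟨ q∸1≡q/3*3 ⟨
  q ∸ 1                   ∎
  where
  open ≡.≡-Reasoning
  q∸1≡q/3*3 : q ∸ 1 ≡ q / 3 ℕ.* 3
  q∸1≡q/3*3 = ≡.cong (_∸ 1) (≡.trans (m≡m%n+[m/n]*n q 3) (≡.cong (ℕ._+ q / 3 ℕ.* 3) q%3≡1))

modular-inverse : ∀ i N .{{_ : NonZero N}} → gcd i N ≡ 1 → ∃ λ i′ → (i ℕ.* i′) % N ≡ 1 % N
modular-inverse i N@(suc N′) gcd≡1 with Bézout.identity (gcd-GCD i N)
... | Bézout.+- u v gcd+vN≡ui = u , (begin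
  (i ℕ.* u) % N              ≡⟨ %-congˡ (≡.trans (ℕ.*-comm i u) (≡.sym gcd+vN≡ui)) ⟩
  (gcd i N ℕ.+ v ℕ.* N) % N  ≡⟨ [m+kn]%n≡m%n (gcd i N) v N ⟩
  gcd i N % N                ≡⟨ %-congˡ gcd≡1 ⟩
  1 % N                      ∎)
  where open ≡.≡-Reasoning
-- In this case u i ≡ -1 (mod N), so u (N - 1) inverts i.
... | Bézout.-+ u v gcd+ui≡vN = u ℕ.* N′ , (begin
  (i ℕ.* (u ℕ.* N′)) % N                    ≡⟨ [m+n]%n≡m%n (i ℕ.* (u ℕ.* N′)) N ⟨
  (i ℕ.* (u ℕ.* N′) ℕ.+ N) % N              ≡⟨ %-congˡ (solve 3 (λ i u N′ → i :* (u :* N′) :+ (con 1 :+ N′)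
                                                                  := con 1 :+ N′ :* (con 1 :+ u :* i)) ≡.refl i u N′) ⟩
  (1 ℕ.+ N′ ℕ.* (1 ℕ.+ u ℕ.* i)) % N         ≡⟨ %-congˡ (≡.cong (λ g → 1 ℕ.+ N′ ℕ.* (g ℕ.+ u ℕ.* i)) (≡.sym gcd≡1)) ⟩
  (1 ℕ.+ N′ ℕ.* (gcd i N ℕ.+ u ℕ.* i)) % N   ≡⟨ %-congˡ (≡.cong (λ m → 1 ℕ.+ N′ ℕ.* m) gcd+ui≡vN) ⟩
  (1 ℕ.+ N′ ℕ.* (v ℕ.* N)) % N               ≡⟨ %-congˡ (≡.cong (1 ℕ.+_) (≡.sym (ℕ.*-assoc N′ v N))) ⟩
  (1 ℕ.+ N′ ℕ.* v ℕ.* N) % N                 ≡⟨ [m+kn]%n≡m%n 1 (N′ ℕ.* v) N ⟩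
  1 % N                                     ∎)
  where
  open ≡.≡-Reasoning
  open +-*-Solver using (solve; _:+_; _:*_; _:=_; con)

module MultiplicationModulo (N : ℕ) .{{_ : NonZero N}} where
  open import Data.Fin.Permutation using (Permutation; permutation)
  open ≡.≡-Reasoning

  _*%_ : ℕ → Fin N → Fin N
  c *% j = Fin.fromℕ< (m%n<n (c ℕ.* toℕ j) N)

  toℕ-*% : ∀ c j → toℕ (c *% j) ≡ (c ℕ.* toℕ j) % N
  toℕ-*% c j = Fin.toℕ-fromℕ< (m%n<n (c ℕ.* toℕ j) N)

  m*[n%N]%N≡m*n%N : ∀ m n → (m ℕ.* (n % N)) % N ≡ (m ℕ.* n) % N
  m*[n%N]%N≡m*n%N m n = begin
    (m ℕ.* (n % N)) % N            ≡⟨ %-distribˡ-* m (n % N) N ⟩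
    ((m % N) ℕ.* (n % N % N)) % N  ≡⟨ ≡.cong (λ t → ((m % N) ℕ.* t) % N) (m%n%n≡m%n n N) ⟩
    ((m % N) ℕ.* (n % N)) % N      ≡⟨ %-distribˡ-* m n N ⟨
    (m ℕ.* n) % N                  ∎

  *%-inverse : ∀ c c′ → (c ℕ.* c′) % N ≡ 1 % N → ∀ j → c *% (c′ *% j) ≡ j
  *%-inverse c c′ cc′≡1 j = Fin.toℕ-injective (begin
    toℕ (c *% (c′ *% j))                ≡⟨ toℕ-*% c (c′ *% j) ⟩
    (c ℕ.* toℕ (c′ *% j)) % N           ≡⟨ ≡.cong (λ t → (c ℕ.* t) % N) (toℕ-*% c′ j) ⟩
    (c ℕ.* ((c′ ℕ.* toℕ j) % N)) % N    ≡⟨ m*[n%N]%N≡m*n%N c (c′ ℕ.* toℕ j) ⟩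
    (c ℕ.* (c′ ℕ.* toℕ j)) % N          ≡⟨ ≡.cong (_% N) (≡.trans (ℕ.*-comm (toℕ j) (c ℕ.* c′)) (ℕ.*-assoc c c′ (toℕ j))) ⟨
    (toℕ j ℕ.* (c ℕ.* c′)) % N          ≡⟨ m*[n%N]%N≡m*n%N (toℕ j) (c ℕ.* c′) ⟨
    (toℕ j ℕ.* ((c ℕ.* c′) % N)) % N    ≡⟨ ≡.cong (λ t → (toℕ j ℕ.* t) % N) cc′≡1 ⟩
    (toℕ j ℕ.* (1 % N)) % N             ≡⟨ m*[n%N]%N≡m*n%N (toℕ j) 1 ⟩
    (toℕ j ℕ.* 1) % N                   ≡⟨ ≡.cong (_% N) (ℕ.*-identityʳ (toℕ j)) ⟩
    toℕ j % N                           ≡⟨ m<n⇒m%n≡m (Fin.toℕ<n j) ⟩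
    toℕ j                               ∎)

  *%-permutation : ∀ i → gcd i N ≡ 1 → Permutation N N
  *%-permutation i gcd≡1 with modular-inverse i N gcd≡1
  ... | i′ , ii′≡1 = permutation (i *%_) (i′ *%_) (*%-inverse i i′ ii′≡1)
    (*%-inverse i′ i (≡.trans (≡.cong (_% N) (ℕ.*-comm i′ i)) ii′≡1))

-- The ring solver needs coefficients whose equality computes, so we use ℤ
-- through its canonical map into R rather than R itself.
module IntegerCoefficientRingSolver {c ℓ} (R : CommutativeRing c ℓ) where
  open CommutativeRing R
  open import Data.Integer as ℤ using (ℤ; +_; -[1+_]; _⊖_)
  import Data.Integer.Properties as ℤ
  open import Data.Sign as Sign using (Sign)
  open import Data.Maybe using (Maybe; just; nothing)
  open import Algebra.Properties.Ring ring
    using (-‿involutive; -‿distribˡ-*; -‿distribʳ-*; -‿+-comm; -0#≈0#)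
  open import Algebra.Properties.Semiring.Mult semiring
    using (×-homo-+; ×1-homo-*; ×-congˡ) renaming (_×_ to _×′_)
  open import Algebra.Solver.Ring.AlmostCommutativeRing
  open import Relation.Binary.Reasoning.Setoid setoid

  signed : Sign → Carrier → Carrier
  signed Sign.+ x = x
  signed Sign.- x = - x

  ⟦_⟧ℤ : ℤ → Carrier
  ⟦ + n ⟧ℤ      = n ×′ 1#
  ⟦ -[1+ n ] ⟧ℤ = - (suc n ×′ 1#)

  ⟦◃⟧ : ∀ s n → ⟦ s ℤ.◃ n ⟧ℤ ≈ signed s (n ×′ 1#)
  ⟦◃⟧ Sign.+ zero    = refl
  ⟦◃⟧ Sign.- zero    = sym -0#≈0#
  ⟦◃⟧ Sign.+ (suc n) = refl
  ⟦◃⟧ Sign.- (suc n) = refl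

  ⟦⟧ℤ-signAbs : ∀ i → ⟦ i ⟧ℤ ≈ signed (ℤ.sign i) (ℤ.∣ i ∣ ×′ 1#)
  ⟦⟧ℤ-signAbs (+ n)    = refl
  ⟦⟧ℤ-signAbs -[1+ n ] = refl

  ⟦⟧ℤ-homo-‿ : ∀ i → ⟦ ℤ.- i ⟧ℤ ≈ - ⟦ i ⟧ℤ
  ⟦⟧ℤ-homo-‿ (+ zero)  = sym -0#≈0#
  ⟦⟧ℤ-homo-‿ (+ suc n) = refl
  ⟦⟧ℤ-homo-‿ -[1+ n ]  = sym (-‿involutive _)

  ×1-homo-∸ : ∀ {m n} → n ℕ.≤ m → (m ∸ n) ×′ 1# ≈ m ×′ 1# - n ×′ 1#
  ×1-homo-∸ {m} {n} n≤m = begin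
    (m ∸ n) ×′ 1#                      ≈⟨ sym (+-identityʳ _) ⟩
    (m ∸ n) ×′ 1# + 0#                 ≈⟨ +-congˡ (sym (-‿inverseʳ (n ×′ 1#))) ⟩
    (m ∸ n) ×′ 1# + (n ×′ 1# - n ×′ 1#)  ≈⟨ sym (+-assoc _ _ _) ⟩
    ((m ∸ n) ×′ 1# + n ×′ 1#) - n ×′ 1#  ≈⟨ +-congʳ (sym (×-homo-+ 1# (m ∸ n) n)) ⟩
    ((m ∸ n) ℕ.+ n) ×′ 1# - n ×′ 1#     ≈⟨ +-congʳ (×-congˡ (ℕ.m∸n+n≡m n≤m)) ⟩
    m ×′ 1# - n ×′ 1#                   ∎

  ⟦⊖⟧ : ∀ m n → ⟦ m ⊖ n ⟧ℤ ≈ m ×′ 1# - n ×′ 1#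
  ⟦⊖⟧ m n with ℕ.≤-<-connex n m
  ... | inj₁ n≤m = trans (reflexive (≡.cong ⟦_⟧ℤ (ℤ.⊖-≥ n≤m))) (×1-homo-∸ n≤m)
  ... | inj₂ m<n = begin
    ⟦ m ⊖ n ⟧ℤ                 ≈⟨ reflexive (≡.cong ⟦_⟧ℤ (ℤ.⊖-< m<n)) ⟩
    ⟦ ℤ.- (+ (n ∸ m)) ⟧ℤ       ≈⟨ ⟦⟧ℤ-homo-‿ (+ (n ∸ m)) ⟩
    - ((n ∸ m) ×′ 1#)           ≈⟨ -‿cong (×1-homo-∸ (ℕ.<⇒≤ m<n)) ⟩
    - (n ×′ 1# - m ×′ 1#)        ≈⟨ sym (-‿+-comm _ _) ⟩
    - (n ×′ 1#) + - - (m ×′ 1#)  ≈⟨ +-congˡ (-‿involutive _) ⟩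
    - (n ×′ 1#) + m ×′ 1#        ≈⟨ +-comm _ _ ⟩
    m ×′ 1# - n ×′ 1#            ∎

  ⟦⟧ℤ-homo-+ : ∀ i j → ⟦ i ℤ.+ j ⟧ℤ ≈ ⟦ i ⟧ℤ + ⟦ j ⟧ℤ
  ⟦⟧ℤ-homo-+ -[1+ m ] -[1+ n ] = begin
    - (suc (suc (m ℕ.+ n)) ×′ 1#)     ≈⟨ -‿cong (×-congˡ (≡.cong suc (≡.sym (ℕ.+-suc m n)))) ⟩
    - ((suc m ℕ.+ suc n) ×′ 1#)       ≈⟨ -‿cong (×-homo-+ 1# (suc m) (suc n)) ⟩
    - (suc m ×′ 1# + suc n ×′ 1#)      ≈⟨ sym (-‿+-comm _ _) ⟩
    - (suc m ×′ 1#) + - (suc n ×′ 1#)  ∎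
  ⟦⟧ℤ-homo-+ -[1+ m ] (+ n)    = trans (⟦⊖⟧ n (suc m)) (+-comm _ _)
  ⟦⟧ℤ-homo-+ (+ m)    -[1+ n ] = ⟦⊖⟧ m (suc n)
  ⟦⟧ℤ-homo-+ (+ m)    (+ n)    = ×-homo-+ 1# m n

  signed-* : ∀ s t x y → signed (s Sign.* t) (x * y) ≈ signed s x * signed t y
  signed-* Sign.+ Sign.+ x y = refl
  signed-* Sign.+ Sign.- x y = -‿distribʳ-* x y
  signed-* Sign.- Sign.+ x y = -‿distribˡ-* x y
  signed-* Sign.- Sign.- x y = begin
    x * y          ≈⟨ sym (-‿involutive _) ⟩
    - - (x * y)    ≈⟨ -‿cong (-‿distribʳ-* x y) ⟩
    - (x * - y)    ≈⟨ -‿distribˡ-* x (- y) ⟩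
    - x * - y      ∎

  signed-cong : ∀ s {x y} → x ≈ y → signed s x ≈ signed s y
  signed-cong Sign.+ x≈y = x≈y
  signed-cong Sign.- x≈y = -‿cong x≈y

  ⟦⟧ℤ-homo-* : ∀ i j → ⟦ i ℤ.* j ⟧ℤ ≈ ⟦ i ⟧ℤ * ⟦ j ⟧ℤ
  ⟦⟧ℤ-homo-* i j = begin
    ⟦ s ℤ.◃ ∣i∣ ℕ.* ∣j∣ ⟧ℤ                     ≈⟨ ⟦◃⟧ s (∣i∣ ℕ.* ∣j∣) ⟩
    signed s ((∣i∣ ℕ.* ∣j∣) ×′ 1#)              ≈⟨ signed-cong s (×1-homo-* ∣i∣ ∣j∣) ⟩
    signed s ((∣i∣ ×′ 1#) * (∣j∣ ×′ 1#))         ≈⟨ signed-* (ℤ.sign i) (ℤ.sign j) _ _ ⟩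
    signed (ℤ.sign i) (∣i∣ ×′ 1#) * signed (ℤ.sign j) (∣j∣ ×′ 1#)
                                               ≈⟨ sym (*-cong (⟦⟧ℤ-signAbs i) (⟦⟧ℤ-signAbs j)) ⟩
    ⟦ i ⟧ℤ * ⟦ j ⟧ℤ                            ∎
    where
    s : Sign
    s = ℤ.sign i Sign.* ℤ.sign j
    ∣i∣ ∣j∣ : ℕ
    ∣i∣ = ℤ.∣ i ∣
    ∣j∣ = ℤ.∣ j ∣

  ℤ-morphism : CommutativeRing.rawRing ℤ.+-*-commutativeRing
               -Raw-AlmostCommutative⟶ fromCommutativeRing R
  ℤ-morphism = record
    { ⟦_⟧ = ⟦_⟧ℤ ; +-homo = ⟦⟧ℤ-homo-+ ; *-homo = ⟦⟧ℤ-homo-* ; -‿homo = ⟦⟧ℤ-homo-‿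
    ; 0-homo = refl ; 1-homo = +-identityʳ 1# }

  ≡⇒⟦⟧ℤ-≈ : ∀ i j → Maybe (⟦ i ⟧ℤ ≈ ⟦ j ⟧ℤ)
  ≡⇒⟦⟧ℤ-≈ i j with i ℤ.≟ j
  ... | yes ≡.refl = just refl
  ... | no _       = nothing

  open import Algebra.Solver.Ring _ _ ℤ-morphism ≡⇒⟦⟧ℤ-≈ public

module IndexedProduct {c ℓ} (M : CommutativeMonoid c ℓ) where
  open CommutativeMonoid M
  open import Algebra.Properties.CommutativeMonoid.Sum M using (sum; ∑-permute; sum-cong-≋)
  open import Algebra.Properties.Monoid.Sum monoid using (sum-init-last)
  open import Data.Fin.Permutation using (Permutation; _⟨$⟩ʳ_)
  open import Relation.Binary.Reasoning.Setoid setoid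

  ∏< : ℕ → (ℕ → Carrier) → Carrier
  ∏< zero    h = ε
  ∏< (suc k) h = ∏< k h ∙ h k

  ∏<≈sum : ∀ k h → ∏< k h ≈ sum {k} (λ j → h (toℕ j))
  ∏<≈sum zero    h = refl
  ∏<≈sum (suc k) h = sym (begin
    sum {suc k} (λ j → h (toℕ j))                              ≈⟨ sum-init-last {k} (λ j → h (toℕ j)) ⟩
    sum {k} (λ j → h (toℕ (inject₁ j))) ∙ h (toℕ (fromℕ k))    ≈⟨ ∙-cong (sum-cong-≋ {k} (λ j → reflexive (≡.cong h (Fin.toℕ-inject₁ j))))
                                                                          (reflexive (≡.cong h (Fin.toℕ-fromℕ k))) ⟩
    sum {k} (λ j → h (toℕ j)) ∙ h k                            ≈⟨ ∙-congʳ (∏<≈sum k h) ⟨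
    ∏< k h ∙ h k                                               ∎)

  ∏<-permute : ∀ {N} (π : Permutation N N) {g h : ℕ → Carrier} →
               (∀ j → g (toℕ (π ⟨$⟩ʳ j)) ≈ h (toℕ j)) → ∏< N g ≈ ∏< N h
  ∏<-permute {N} π {g} {h} g∘π≈h = begin
    ∏< N g                                ≈⟨ ∏<≈sum N g ⟩
    sum {N} (λ j → g (toℕ j))             ≈⟨ ∑-permute (λ j → g (toℕ j)) π ⟩
    sum {N} (λ j → g (toℕ (π ⟨$⟩ʳ j)))    ≈⟨ sum-cong-≋ {N} g∘π≈h ⟩
    sum {N} (λ j → h (toℕ j))             ≈⟨ ∏<≈sum N h ⟨
    ∏< N h                                ∎

module PrimeCharacteristic {c ℓ} (S : CommutativeSemiring c ℓ) where
  open CommutativeSemiring S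
  open import Algebra.Properties.Semiring.Mult semiring
    using (×-assoc-*; ×1-homo-*; ×-congˡ; ×-homo-1) renaming (_×_ to _×′_)
  open import Algebra.Properties.Monoid.Mult +-monoid using () renaming (×-congʳ to ×-congʳ′)
  open import Algebra.Properties.Semiring.Exp semiring using (_^_; ^-congʳ; ^-congˡ; ^-assocʳ)
  open import Algebra.Properties.Monoid.Sum +-monoid using (sum; sum-init-last; sum-cong-≋; sum-replicate-zero)
  import Algebra.Properties.CommutativeSemiring.Binomial S as Binomial
  open import Relation.Binary.Reasoning.Setoid setoid

  Additive : ℕ → Set (c ⊔ ℓ)
  Additive e = ∀ x y → (x + y) ^ e ≈ x ^ e + y ^ e

  Additive-* : ∀ {a b} → Additive a → Additive b → Additive (a ℕ.* b)
  Additive-* {a} {b} +-a +-b x y = begin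
    (x + y) ^ (a ℕ.* b)         ≈⟨ ^-assocʳ _ a b ⟨
    ((x + y) ^ a) ^ b           ≈⟨ ^-congˡ b (+-a x y) ⟩
    (x ^ a + y ^ a) ^ b         ≈⟨ +-b _ _ ⟩
    (x ^ a) ^ b + (y ^ a) ^ b   ≈⟨ +-cong (^-assocʳ x a b) (^-assocʳ y a b) ⟩
    x ^ (a ℕ.* b) + y ^ (a ℕ.* b) ∎

  Additive-^ : ∀ {a} → Additive a → ∀ m → Additive (a ℕ.^ m)
  Additive-^ +-a zero    x y = trans (*-identityʳ _) (sym (+-cong (*-identityʳ x) (*-identityʳ y)))
  Additive-^ {a} +-a (suc m) = Additive-* {a} {a ℕ.^ m} +-a (Additive-^ +-a m)

  ×1#-homo-^ : ∀ m e → (m ℕ.^ e) ×′ 1# ≈ (m ×′ 1#) ^ e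
  ×1#-homo-^ m zero    = +-identityʳ 1#
  ×1#-homo-^ m (suc e) = trans (×1-homo-* m (m ℕ.^ e)) (*-congˡ (×1#-homo-^ m e))

  p∣m⇒m×x≈0 : ∀ {p m} → p ×′ 1# ≈ 0# → p ∣ m → ∀ x → m ×′ x ≈ 0#
  p∣m⇒m×x≈0 {p} p×1≈0 (divides d ≡.refl) x = begin
    (d ℕ.* p) ×′ x            ≈⟨ ×-congʳ′ (d ℕ.* p) (sym (*-identityˡ x)) ⟩
    (d ℕ.* p) ×′ (1# * x)     ≈⟨ sym (×-assoc-* (d ℕ.* p) 1# x) ⟩
    ((d ℕ.* p) ×′ 1#) * x     ≈⟨ *-congʳ (×1-homo-* d p) ⟩
    (d ×′ 1#) * (p ×′ 1#) * x ≈⟨ *-congʳ (*-congˡ p×1≈0) ⟩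
    (d ×′ 1#) * 0# * x        ≈⟨ *-congʳ (zeroʳ _) ⟩
    0# * x                    ≈⟨ zeroˡ x ⟩
    0#                        ∎

  ^p-additive : ∀ {p} → Prime p → p ×′ 1# ≈ 0# → Additive p
  ^p-additive {suc (suc r)} p-prime p×1≈0 x y = begin
    (x + y) ^ p                                        ≈⟨ Binomial.theorem p x y ⟩
    t Fin.zero + sum (λ k → t (Fin.suc k))             ≈⟨ +-congˡ (sum-init-last (λ k → t (Fin.suc k))) ⟩
    t Fin.zero + (sum (λ k → t (Fin.suc (inject₁ k))) + t last)
                                                       ≈⟨ +-congˡ (+-congʳ middle≈0) ⟩
    t Fin.zero + (0# + t last)                         ≈⟨ +-congˡ (+-identityˡ _) ⟩
    t Fin.zero + t last                                ≈⟨ +-comm _ _ ⟩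
    t last + t Fin.zero                                ≈⟨ +-cong last≈x^p first≈y^p ⟩
    x ^ p + y ^ p                                      ∎
    where
    p : ℕ
    p = suc (suc r)
    t : Fin (suc p) → Carrier
    t = Binomial.binomialTerm x y p
    last : Fin (suc p)
    last = Fin.suc (fromℕ (suc r))
    middle≈0 : sum (λ k → t (Fin.suc (inject₁ k))) ≈ 0#
    middle≈0 = begin
      sum (λ k → t (Fin.suc (inject₁ k)))  ≈⟨ sum-cong-≋ {suc r} (λ k →
                                                p∣m⇒m×x≈0 p×1≈0 (p∣pCk k) (Binomial.binomial x y p (Fin.suc (inject₁ k)))) ⟩
      sum {suc r} (λ _ → 0#)               ≈⟨ sum-replicate-zero (suc r) ⟩
      0#                                   ∎
      where
      p∣pCk : (k : Fin (suc r)) → p ∣ p C suc (toℕ (inject₁ k))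
      p∣pCk k = prime∣choose p-prime (s≤s z≤n) (s≤s (≡.subst (ℕ._< _) (≡.sym (Fin.toℕ-inject₁ k)) (Fin.toℕ<n k)))
    first≈y^p : t Fin.zero ≈ y ^ p
    first≈y^p = trans (×-homo-1 _) (*-identityˡ _)
    last≈x^p : t last ≈ x ^ p
    last≈x^p = begin
      (p C toℕ last) ×′ (x ^ toℕ last * y ^ (p ∸ toℕ last))  ≈⟨ ×-congˡ (≡.trans (≡.cong (p C_) toℕ[last]≡p) (nCn≡1 p)) ⟩
      1 ×′ (x ^ toℕ last * y ^ (p ∸ toℕ last))               ≈⟨ ×-homo-1 _ ⟩
      x ^ toℕ last * y ^ (p ∸ toℕ last)                      ≈⟨ *-cong (^-congʳ x toℕ[last]≡p) (^-congʳ y p∸toℕ[last]≡0) ⟩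
      x ^ p * 1#                                             ≈⟨ *-identityʳ _ ⟩
      x ^ p                                                  ∎
      where
      toℕ[last]≡p : toℕ last ≡ p
      toℕ[last]≡p = ≡.cong suc (Fin.toℕ-fromℕ (suc r))
      p∸toℕ[last]≡0 : p ∸ toℕ last ≡ 0
      p∸toℕ[last]≡0 = ≡.trans (≡.cong (p ∸_) toℕ[last]≡p) (ℕ.n∸n≡0 p)

module FiniteRing {c ℓ} (R : CommutativeRing c ℓ) {N} (size : HasSize R N) where
  open CommutativeRing R
  open import Algebra.Properties.Group +-group
    using (//-rightDividesˡ; //-rightDividesʳ) renaming (∙-cancelˡ to +-cancelˡ)
  open import Algebra.Properties.Semiring.Mult semiring using () renaming (_×_ to _×′_)
  open import Algebra.Properties.CommutativeMonoid.Sum +-commutativeMonoid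
    using (sum; ∑-permute; ∑-distrib-+; sum-replicate; sum-cong-≋)
  open import Data.Fin.Permutation using (Permutation; permutation)
  open import Function.Bundles using (Bijection; Inverse)
  open import Function.Properties.Bijection using (Bijection⇒Inverse)
  open import Relation.Binary.Reasoning.Setoid setoid
  open Inverse (Bijection⇒Inverse size) using (to; from; inverseˡ; inverseʳ)

  _≟_ : ∀ x y → Dec (x ≈ y)
  x ≟ y with to x Fin.≟ to y
  ... | yes tx≡ty = yes (Bijection.injective size tx≡ty)
  ... | no  tx≢ty = no (λ x≈y → tx≢ty (Bijection.cong size x≈y))

  translation : Carrier → Permutation N N
  translation a = permutation (λ k → to (from k + a)) (λ k → to (from k - a))
    (λ k → inverseˡ (trans (+-congʳ (inverseʳ ≡.refl)) (//-rightDividesˡ a (from k))))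
    (λ k → inverseˡ (trans (+-congʳ (inverseʳ ≡.refl)) (//-rightDividesʳ a (from k))))

  size×1#≈0# : N ×′ 1# ≈ 0#
  size×1#≈0# = sym (+-cancelˡ S _ _ (begin
    S + 0#                        ≈⟨ +-identityʳ S ⟩
    S                             ≈⟨ ∑-permute from (translation 1#) ⟩
    sum (λ k → from (to (from k + 1#))) ≈⟨ sum-cong-≋ {N} (λ k → inverseʳ ≡.refl) ⟩
    sum {N} (λ k → from k + 1#)   ≈⟨ ∑-distrib-+ from (λ _ → 1#) ⟩
    S + sum {N} (λ _ → 1#)        ≈⟨ +-congˡ (sum-replicate N) ⟩
    S + N ×′ 1#                   ∎))
    where
    S : Carrier
    S = sum from

module Field {c ℓ} (F : CommutativeRing c ℓ) (isField : IsField F) (_≟_ : ∀ x y → Dec (CommutativeRing._≈_ F x y)) where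
  open CommutativeRing F
  open import Algebra.Properties.Ring ring using (-‿involutive; -0#≈0#)
  open import Algebra.Properties.Semiring.Exp semiring using (_^_)
  open import Algebra.Properties.Semiring.Mult semiring using () renaming (_×_ to _×′_)
  open PrimeCharacteristic commutativeSemiring using (×1#-homo-^)
  open import Relation.Binary.Reasoning.Setoid setoid

  1≉0 : 1# ≉ 0#
  1≉0 = proj₁ isField

  -- 0⁻¹ is the junk value 0#.
  _⁻¹ : Carrier → Carrier
  x ⁻¹ with x ≟ 0#
  ... | yes _   = 0#
  ... | no  x≉0 = proj₁ (proj₂ isField x x≉0)

  ⁻¹-inverseʳ : ∀ {x} → x ≉ 0# → x * x ⁻¹ ≈ 1#
  ⁻¹-inverseʳ {x} x≉0 with x ≟ 0#
  ... | yes x≈0  = ⊥-elim (x≉0 x≈0)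
  ... | no  x≉0′ = proj₂ (proj₂ isField x x≉0′)

  ⁻¹-inverseˡ : ∀ {x} → x ≉ 0# → x ⁻¹ * x ≈ 1#
  ⁻¹-inverseˡ x≉0 = trans (*-comm _ _) (⁻¹-inverseʳ x≉0)

  x*y≈z⇒y≈x⁻¹*z : ∀ {x y z} → x ≉ 0# → x * y ≈ z → y ≈ x ⁻¹ * z
  x*y≈z⇒y≈x⁻¹*z {x} {y} {z} x≉0 x*y≈z = begin
    y              ≈⟨ *-identityˡ y ⟨
    1# * y         ≈⟨ *-congʳ (⁻¹-inverseˡ x≉0) ⟨
    (x ⁻¹ * x) * y ≈⟨ *-assoc _ _ _ ⟩
    x ⁻¹ * (x * y) ≈⟨ *-congˡ x*y≈z ⟩
    x ⁻¹ * z       ∎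

  *-cancelˡ : ∀ {x y z} → x ≉ 0# → x * y ≈ x * z → y ≈ z
  *-cancelˡ x≉0 xy≈xz =
    trans (x*y≈z⇒y≈x⁻¹*z x≉0 xy≈xz) (sym (x*y≈z⇒y≈x⁻¹*z x≉0 refl))

  *-cancelʳ : ∀ {x y z} → x ≉ 0# → y * x ≈ z * x → y ≈ z
  *-cancelʳ x≉0 yx≈zx = *-cancelˡ x≉0 (trans (*-comm _ _) (trans yx≈zx (*-comm _ _)))

  x*y≈0⇒y≈0 : ∀ {x y} → x ≉ 0# → x * y ≈ 0# → y ≈ 0#
  x*y≈0⇒y≈0 x≉0 xy≈0 = *-cancelˡ x≉0 (trans xy≈0 (sym (zeroʳ _)))

  *-≉0 : ∀ {x y} → x ≉ 0# → y ≉ 0# → x * y ≉ 0#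
  *-≉0 x≉0 y≉0 xy≈0 = y≉0 (x*y≈0⇒y≈0 x≉0 xy≈0)

  -‿≉0 : ∀ {x} → x ≉ 0# → - x ≉ 0#
  -‿≉0 x≉0 -x≈0 = x≉0 (trans (sym (-‿involutive _)) (trans (-‿cong -x≈0) -0#≈0#))

  ^-≉0 : ∀ {x} n → x ≉ 0# → x ^ n ≉ 0#
  ^-≉0 zero    x≉0 = 1≉0
  ^-≉0 (suc n) x≉0 = *-≉0 x≉0 (^-≉0 n x≉0)

  ^≈0⇒≈0 : ∀ {x} n → x ^ n ≈ 0# → x ≈ 0#
  ^≈0⇒≈0 {x} n xⁿ≈0 with x ≟ 0#
  ... | yes x≈0 = x≈0
  ... | no  x≉0 = ⊥-elim (^-≉0 n x≉0 xⁿ≈0)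

  ⁻¹-≉0 : ∀ {x} → x ≉ 0# → x ⁻¹ ≉ 0#
  ⁻¹-≉0 x≉0 x⁻¹≈0 = 1≉0 (trans (sym (⁻¹-inverseʳ x≉0)) (trans (*-congˡ x⁻¹≈0) (zeroʳ _)))

  ^×1#≈0⇒×1#≈0 : ∀ m e → (m ℕ.^ e) ×′ 1# ≈ 0# → m ×′ 1# ≈ 0#
  ^×1#≈0⇒×1#≈0 m e mᵉ≈0 = ^≈0⇒≈0 e (trans (sym (×1#-homo-^ m e)) mᵉ≈0)

  ⁻¹-unique : ∀ {x y} → x * y ≈ 1# → x ⁻¹ ≈ y
  ⁻¹-unique {x} {y} xy≈1 = *-cancelˡ x≉0 (trans (⁻¹-inverseʳ x≉0) (sym xy≈1))
    where
    x≉0 : x ≉ 0#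
    x≉0 x≈0 = 1≉0 (trans (sym xy≈1) (trans (*-congʳ x≈0) (zeroˡ _)))

  ⁻¹-zero : ∀ {x} → x ≈ 0# → x ⁻¹ ≈ 0#
  ⁻¹-zero {x} x≈0 with x ≟ 0#
  ... | yes _   = refl
  ... | no  x≉0 = ⊥-elim (x≉0 x≈0)

  ⁻¹-cong : ∀ {x y} → x ≈ y → x ⁻¹ ≈ y ⁻¹
  ⁻¹-cong {x} {y} x≈y = by-cases (y ≟ 0#)
    where
    by-cases : Dec (y ≈ 0#) → x ⁻¹ ≈ y ⁻¹
    by-cases (yes y≈0) = trans (⁻¹-zero (trans x≈y y≈0)) (sym (⁻¹-zero y≈0))
    by-cases (no  y≉0) = ⁻¹-unique (trans (*-congʳ x≈y) (⁻¹-inverseʳ y≉0))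

  ⁻¹-‿ : ∀ {x} → x ≉ 0# → (- x) ⁻¹ ≈ - (x ⁻¹)
  ⁻¹-‿ {x} x≉0 = ⁻¹-unique (begin
    - x * - (x ⁻¹)   ≈⟨ -‿distribˡ-* x (- (x ⁻¹)) ⟨
    - (x * - (x ⁻¹)) ≈⟨ -‿cong (-‿distribʳ-* x (x ⁻¹)) ⟨
    - - (x * x ⁻¹)   ≈⟨ -‿involutive _ ⟩
    x * x ⁻¹         ≈⟨ ⁻¹-inverseʳ x≉0 ⟩
    1#               ∎)
    where open import Algebra.Properties.Ring ring using (-‿distribˡ-*; -‿distribʳ-*)

^q-additive : ∀ {c ℓ} (F : CommutativeRing c ℓ) → IsField F → ∀ {q N} → IsPrimePower q → HasSize F (q ℕ.^ N) →
              PrimeCharacteristic.Additive (CommutativeRing.commutativeSemiring F) q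
^q-additive F isField {N = N} (p , k , p-prime , ≡.refl) size = Additive-^ {p} (^p-additive p-prime p×1#≈0#) (suc k)
  where
  open CommutativeRing F
  open FiniteRing F size using (_≟_; size×1#≈0#)
  open Field F isField _≟_ using (^×1#≈0⇒×1#≈0)
  open PrimeCharacteristic commutativeSemiring using (^p-additive; Additive-^)
  open import Algebra.Properties.Semiring.Mult semiring using () renaming (_×_ to _×′_)
  p×1#≈0# : p ×′ 1# ≈ 0#
  p×1#≈0# = ^×1#≈0⇒×1#≈0 p (suc k ℕ.* N)
    (trans (reflexive (≡.cong (_×′ 1#) (≡.sym (ℕ.^-*-assoc p (suc k) N)))) size×1#≈0#)

module Frobenius {c ℓ} (F : CommutativeRing c ℓ) (isField : IsField F)
  (_≟_ : ∀ x y → Dec (CommutativeRing._≈_ F x y)) (q : ℕ) .{{_ : NonZero q}}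
  (q-additive : PrimeCharacteristic.Additive (CommutativeRing.commutativeSemiring F) q) where
  open CommutativeRing F
  open FieldNotions F q
  open Field F isField _≟_
  open PrimeCharacteristic commutativeSemiring using (Additive-^)
  open import Algebra.Properties.Semiring.Exp semiring using (^-congˡ; ^-congʳ; ^-assocʳ)
  open import Algebra.Properties.CommutativeSemiring.Exp commutativeSemiring using (^-distrib-*)
  open import Algebra.Properties.Group +-group using (x∙y⁻¹≈ε⇒x≈y; inverseʳ-unique)
  open import Relation.Binary.Reasoning.Setoid setoid

  frob : ℕ → Carrier → Carrier
  frob m x = x ^ (q ℕ.^ m)

  frob-cong : ∀ m {x y} → x ≈ y → frob m x ≈ frob m y
  frob-cong m = ^-congˡ (q ℕ.^ m)

  frob-≡ : ∀ {m m′} x → m ≡ m′ → frob m x ≈ frob m′ x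
  frob-≡ x ≡.refl = refl

  frob-+ : ∀ m x y → frob m (x + y) ≈ frob m x + frob m y
  frob-+ m = Additive-^ q-additive m

  frob-* : ∀ m x y → frob m (x * y) ≈ frob m x * frob m y
  frob-* m x y = ^-distrib-* x y (q ℕ.^ m)

  frob-1# : ∀ m → frob m 1# ≈ 1#
  frob-1# m = 1^ (q ℕ.^ m)
    where
    1^ : ∀ e → 1# ^ e ≈ 1#
    1^ zero    = refl
    1^ (suc e) = trans (*-identityˡ _) (1^ e)

  frob-0# : ∀ m → frob m 0# ≈ 0#
  frob-0# m = 0^ (q ℕ.^ m) {{ℕ.m^n≢0 q m}}
    where
    0^ : ∀ e → .{{NonZero e}} → 0# ^ e ≈ 0#
    0^ (suc e) = zeroˡ _

  frob-‿ : ∀ m x → frob m (- x) ≈ - frob m x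
  frob-‿ m x = inverseʳ-unique (frob m x) (frob m (- x)) (begin
    frob m x + frob m (- x) ≈⟨ frob-+ m x (- x) ⟨
    frob m (x - x)          ≈⟨ frob-cong m (-‿inverseʳ x) ⟩
    frob m 0#               ≈⟨ frob-0# m ⟩
    0#                      ∎)

  frob-- : ∀ m x y → frob m (x - y) ≈ frob m x - frob m y
  frob-- m x y = trans (frob-+ m x (- y)) (+-congˡ (frob-‿ m y))

  frob-zero : ∀ x → frob 0 x ≈ x
  frob-zero = *-identityʳ

  frob-frob : ∀ a b x → frob a (frob b x) ≈ frob (b ℕ.+ a) x
  frob-frob a b x = trans (^-assocʳ x (q ℕ.^ b) (q ℕ.^ a)) (^-congʳ x (≡.sym (ℕ.^-distribˡ-+-* q b a)))

  frob-comm : ∀ a b x → frob a (frob b x) ≈ frob b (frob a x)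
  frob-comm a b x = trans (frob-frob a b x) (trans (frob-≡ x (ℕ.+-comm b a)) (sym (frob-frob b a x)))

  frob-injective : ∀ m {x y} → frob m x ≈ frob m y → x ≈ y
  frob-injective m {x} {y} fx≈fy = x∙y⁻¹≈ε⇒x≈y x y (^≈0⇒≈0 (q ℕ.^ m) (begin
    frob m (x - y)         ≈⟨ frob-- m x y ⟩
    frob m x - frob m y    ≈⟨ +-congʳ fx≈fy ⟩
    frob m y - frob m y    ≈⟨ -‿inverseʳ _ ⟩
    0#                     ∎))

  frob-≉0 : ∀ m {x} → x ≉ 0# → frob m x ≉ 0#
  frob-≉0 m x≉0 fx≈0 = x≉0 (frob-injective m (trans fx≈0 (sym (frob-0# m))))

  frob-⁻¹ : ∀ m x → frob m (x ⁻¹) ≈ (frob m x) ⁻¹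
  frob-⁻¹ m x = by-cases (x ≟ 0#)
    where
    by-cases : Dec (x ≈ 0#) → frob m (x ⁻¹) ≈ (frob m x) ⁻¹
    by-cases (yes x≈0) = begin
      frob m (x ⁻¹)   ≈⟨ frob-cong m (⁻¹-zero x≈0) ⟩
      frob m 0#       ≈⟨ frob-0# m ⟩
      0#              ≈⟨ ⁻¹-zero (trans (frob-cong m x≈0) (frob-0# m)) ⟨
      (frob m x) ⁻¹   ∎
    by-cases (no x≉0) = sym (⁻¹-unique (begin
      frob m x * frob m (x ⁻¹) ≈⟨ frob-* m x (x ⁻¹) ⟨
      frob m (x * x ⁻¹)        ≈⟨ frob-cong m (⁻¹-inverseʳ x≉0) ⟩
      frob m 1#                ≈⟨ frob-1# m ⟩
      1#                       ∎))

  InSub-cong : ∀ m {x y} → x ≈ y → InSub m x → InSub m y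
  InSub-cong m x≈y x∈ = trans (frob-cong m (sym x≈y)) (trans x∈ x≈y)

  InSub-≡ : ∀ {m m′ x} → m ≡ m′ → InSub m x → InSub m′ x
  InSub-≡ ≡.refl x∈ = x∈

  InSub-0# : ∀ m → InSub m 0#
  InSub-0# = frob-0#

  InSub-1# : ∀ m → InSub m 1#
  InSub-1# = frob-1#

  InSub-+ : ∀ m {x y} → InSub m x → InSub m y → InSub m (x + y)
  InSub-+ m x∈ y∈ = trans (frob-+ m _ _) (+-cong x∈ y∈)

  InSub-* : ∀ m {x y} → InSub m x → InSub m y → InSub m (x * y)
  InSub-* m x∈ y∈ = trans (frob-* m _ _) (*-cong x∈ y∈)

  InSub-‿ : ∀ m {x} → InSub m x → InSub m (- x)
  InSub-‿ m x∈ = trans (frob-‿ m _) (-‿cong x∈)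

  InSub-- : ∀ m {x y} → InSub m x → InSub m y → InSub m (x - y)
  InSub-- m x∈ y∈ = InSub-+ m x∈ (InSub-‿ m y∈)

  InSub-⁻¹ : ∀ m {x} → InSub m x → InSub m (x ⁻¹)
  InSub-⁻¹ m x∈ = trans (frob-⁻¹ m _) (⁻¹-cong x∈)

  InSub-frob : ∀ m j {x} → InSub m x → InSub m (frob j x)
  InSub-frob m j x∈ = trans (frob-comm m j _) (frob-cong j x∈)

  InSub-+ℕ : ∀ a b {x} → InSub a x → InSub b x → InSub (a ℕ.+ b) x
  InSub-+ℕ a b {x} x∈a x∈b = trans (sym (frob-frob b a x)) (trans (frob-cong b x∈a) x∈b)

  InSub-∸ℕ : ∀ a b {x} → InSub (a ℕ.+ b) x → InSub b x → InSub a x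
  InSub-∸ℕ a b {x} x∈a+b x∈b = frob-injective b (trans (frob-frob b a x) (trans x∈a+b (sym x∈b)))

  InSub-*ℕ : ∀ k a {x} → InSub a x → InSub (k ℕ.* a) x
  InSub-*ℕ zero    a x∈ = frob-zero _
  InSub-*ℕ (suc k) a x∈ = InSub-+ℕ a (k ℕ.* a) x∈ (InSub-*ℕ k a x∈)

  InSub-gcd : ∀ a b {x} → InSub a x → InSub b x → InSub (gcd a b) x
  InSub-gcd a b x∈a x∈b with Bézout.identity (gcd-GCD a b)
  ... | Bézout.+- u v g+vb≡ua = InSub-∸ℕ (gcd a b) (v ℕ.* b) (InSub-≡ (≡.sym g+vb≡ua) (InSub-*ℕ u a x∈a)) (InSub-*ℕ v b x∈b)
  ... | Bézout.-+ u v g+ua≡vb = InSub-∸ℕ (gcd a b) (u ℕ.* a) (InSub-≡ (≡.sym g+ua≡vb) (InSub-*ℕ v b x∈b)) (InSub-*ℕ u a x∈a)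

  InSub-1⇒InSub : ∀ m {x} → InSub 1 x → InSub m x
  InSub-1⇒InSub m x∈ = InSub-≡ (ℕ.*-identityʳ m) (InSub-*ℕ m 1 x∈)

  frob-% : ∀ {N x} .{{_ : NonZero N}} → InSub N x → ∀ m → frob (m % N) x ≈ frob m x
  frob-% {N} {x} x∈ m = begin
    frob (m % N) x                         ≈⟨ InSub-*ℕ (m / N) N (InSub-frob N (m % N) x∈) ⟨
    frob ((m / N) ℕ.* N) (frob (m % N) x)  ≈⟨ frob-frob ((m / N) ℕ.* N) (m % N) x ⟩
    frob (m % N ℕ.+ (m / N) ℕ.* N) x       ≈⟨ frob-≡ x (m≡m%n+[m/n]*n m N) ⟨
    frob m x                               ∎

  CubeOf𝔽qUnit : Carrier → Set (c ⊔ ℓ)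
  CubeOf𝔽qUnit z = ∃ λ w → InSub 1 w × w ≉ 0# × z ≈ w ^ 3

  CubeOf𝔽qUnit-cong : ∀ {z z′} → z ≈ z′ → CubeOf𝔽qUnit z → CubeOf𝔽qUnit z′
  CubeOf𝔽qUnit-cong z≈z′ (w , w∈ , w≉0 , z≈w³) = w , w∈ , w≉0 , trans (sym z≈z′) z≈w³

  square≈cube⇒CubeOf𝔽qUnit : ∀ {z w} → InSub 1 z → z ≉ 0# → InSub 1 w → w ≉ 0# →
                             z * z ≈ w ^ 3 → CubeOf𝔽qUnit z
  square≈cube⇒CubeOf𝔽qUnit {z} {w} z∈ z≉0 w∈ w≉0 z²≈w³ =
    z * w ⁻¹ , InSub-* 1 z∈ (InSub-⁻¹ 1 w∈) , *-≉0 z≉0 (⁻¹-≉0 w≉0) , sym (*-cancelʳ (^-≉0 3 w≉0) (begin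
      (z * w ⁻¹) ^ 3 * w ^ 3  ≈⟨ ^-distrib-* (z * w ⁻¹) w 3 ⟨
      (z * w ⁻¹ * w) ^ 3      ≈⟨ ^-congˡ 3 (trans (*-assoc z _ w) (trans (*-congˡ (⁻¹-inverseˡ w≉0)) (*-identityʳ z))) ⟩
      z ^ 3                   ≈⟨ *-congˡ (*-congˡ (*-identityʳ z)) ⟩
      z * (z * z)             ≈⟨ *-congˡ z²≈w³ ⟩
      z * w ^ 3               ∎))

  CubeOf𝔽qUnit⇒^[q∸1]/3≈1 : q % 3 ≡ 1 → ∀ {z} → CubeOf𝔽qUnit z → z ^ ((q ∸ 1) / 3) ≈ 1#
  CubeOf𝔽qUnit⇒^[q∸1]/3≈1 q%3≡1 {z} (w , w∈ , w≉0 , z≈w³) = begin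
    z ^ t              ≈⟨ ^-congˡ t z≈w³ ⟩
    (w ^ 3) ^ t        ≈⟨ ^-assocʳ w 3 t ⟩
    w ^ (3 ℕ.* t)      ≡⟨ ≡.cong (w ^_) (q%3≡1⇒3*[q∸1]/3≡q∸1 {q} q%3≡1) ⟩
    w ^ (q ∸ 1)        ≈⟨ *-cancelˡ w≉0 w*w^[q∸1]≈w*1 ⟩
    1#                 ∎
    where
    t : ℕ
    t = (q ∸ 1) / 3
    w*w^[q∸1]≈w*1 : w * w ^ (q ∸ 1) ≈ w * 1#
    w*w^[q∸1]≈w*1 = begin
      w * w ^ (q ∸ 1)  ≡⟨ ≡.cong (w ^_) (≡.trans (ℕ.suc-pred q) (≡.sym (ℕ.*-identityʳ q))) ⟩
      w ^ (q ℕ.^ 1)    ≈⟨ w∈ ⟩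
      w                ≈⟨ *-identityʳ w ⟨
      w * 1#           ∎

module SemilinearMap {c ℓ} (F : CommutativeRing c ℓ) (isField : IsField F)
  (_≟_ : ∀ x y → Dec (CommutativeRing._≈_ F x y)) (q : ℕ) .{{_ : NonZero q}}
  (q-additive : PrimeCharacteristic.Additive (CommutativeRing.commutativeSemiring F) q)
  (i : ℕ) (a : CommutativeRing.Carrier F) where
  open CommutativeRing F
  open FieldNotions F q
  open Field F isField _≟_
  open Frobenius F isField _≟_ q q-additive
  open IntegerCoefficientRingSolver F using (solve; _:+_; _:*_; _:-_; :-_; _:=_)
  open import Algebra.Properties.Ring ring using (-0#≈0#; x[y-z]≈xy-xz)
  open import Algebra.Properties.Group +-group using (x∙y⁻¹≈ε⇒x≈y; x≈y⇒x∙y⁻¹≈ε; inverseʳ-unique)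
  open import Relation.Binary.Reasoning.Setoid setoid

  open IndexedProduct *-commutativeMonoid using (∏<; ∏<-permute)

  σNorm : Carrier → ℕ → Carrier
  σNorm b k = ∏< k (λ j → frob (i ℕ.* j) b)

  σNorm-+ : ∀ b k m → σNorm b (k ℕ.+ m) ≈ σNorm b k * frob (i ℕ.* k) (σNorm b m)
  σNorm-+ b k zero = begin
    σNorm b (k ℕ.+ 0)                 ≡⟨ ≡.cong (σNorm b) (ℕ.+-identityʳ k) ⟩
    σNorm b k                         ≈⟨ *-identityʳ _ ⟨
    σNorm b k * 1#                    ≈⟨ *-congˡ (frob-1# (i ℕ.* k)) ⟨
    σNorm b k * frob (i ℕ.* k) 1#     ∎
  σNorm-+ b k (suc m) = begin
    σNorm b (k ℕ.+ suc m)             ≡⟨ ≡.cong (σNorm b) (ℕ.+-suc k m) ⟩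
    σNorm b (k ℕ.+ m) * frob (i ℕ.* (k ℕ.+ m)) b
                  ≈⟨ *-cong (σNorm-+ b k m) (trans (frob-≡ b i[k+m]≡im+ik) (sym (frob-frob (i ℕ.* k) (i ℕ.* m) b))) ⟩
    σNorm b k * frob (i ℕ.* k) (σNorm b m) * frob (i ℕ.* k) (frob (i ℕ.* m) b)
                  ≈⟨ *-assoc _ _ _ ⟩
    σNorm b k * (frob (i ℕ.* k) (σNorm b m) * frob (i ℕ.* k) (frob (i ℕ.* m) b))
                  ≈⟨ *-congˡ (frob-* (i ℕ.* k) _ _) ⟨
    σNorm b k * frob (i ℕ.* k) (σNorm b (suc m)) ∎
    where
    i[k+m]≡im+ik : i ℕ.* (k ℕ.+ m) ≡ i ℕ.* m ℕ.+ i ℕ.* k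
    i[k+m]≡im+ik = ≡.trans (ℕ.*-distribˡ-+ i k m) (ℕ.+-comm (i ℕ.* k) (i ℕ.* m))

  σNorm-suc : ∀ b k → σNorm b (suc k) ≈ b * frob i (σNorm b k)
  σNorm-suc b k = begin
    σNorm b (1 ℕ.+ k)                          ≈⟨ σNorm-+ b 1 k ⟩
    1# * frob (i ℕ.* 0) b * frob (i ℕ.* 1) (σNorm b k)
                                               ≈⟨ *-cong (trans (*-identityˡ _) (trans (frob-≡ b (ℕ.*-zeroʳ i)) (frob-zero b)))
                                                         (frob-≡ _ (ℕ.*-identityʳ i)) ⟩
    b * frob i (σNorm b k)                     ∎

  σNorm-≉0 : ∀ {b} k → b ≉ 0# → σNorm b k ≉ 0#
  σNorm-≉0 zero    b≉0 = 1≉0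
  σNorm-≉0 (suc k) b≉0 = *-≉0 (σNorm-≉0 k b≉0) (frob-≉0 (i ℕ.* k) b≉0)

  InSub-σNorm : ∀ m {b} k → InSub m b → InSub m (σNorm b k)
  InSub-σNorm m zero    b∈ = InSub-1# m
  InSub-σNorm m (suc k) b∈ = InSub-* m (InSub-σNorm m k b∈) (InSub-frob m (i ℕ.* k) b∈)

  σNorm-fixed-by-σ : ∀ {b} k → b ≉ 0# → InSub (i ℕ.* k) b → InSub i (σNorm b k)
  σNorm-fixed-by-σ {b} k b≉0 b∈ = *-cancelˡ b≉0 (begin
    b * frob i (σNorm b k)       ≈⟨ σNorm-suc b k ⟨
    σNorm b k * frob (i ℕ.* k) b ≈⟨ *-congˡ b∈ ⟩
    σNorm b k * b                ≈⟨ *-comm _ _ ⟩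
    b * σNorm b k                ∎)

  σNorm-*ℕ : ∀ {n b} → InSub n b → ∀ k → σNorm b (k ℕ.* n) ≈ σNorm b n ^ k
  σNorm-*ℕ {n} {b} b∈ zero    = refl
  σNorm-*ℕ {n} {b} b∈ (suc k) = begin
    σNorm b (n ℕ.+ k ℕ.* n)                    ≈⟨ σNorm-+ b n (k ℕ.* n) ⟩
    σNorm b n * frob (i ℕ.* n) (σNorm b (k ℕ.* n)) ≈⟨ *-congˡ (InSub-*ℕ i n (InSub-σNorm n (k ℕ.* n) b∈)) ⟩
    σNorm b n * σNorm b (k ℕ.* n)              ≈⟨ *-congˡ (σNorm-*ℕ b∈ k) ⟩
    σNorm b n * σNorm b n ^ k                  ∎

  T : Carrier → Carrier
  T u = a * frob i u

  T^ : ℕ → Carrier → Carrier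
  T^ zero    u = u
  T^ (suc k) u = T^ k (T u)

  T-cong : ∀ {u v} → u ≈ v → T u ≈ T v
  T-cong u≈v = *-congˡ (frob-cong i u≈v)

  T^-cong : ∀ k {u v} → u ≈ v → T^ k u ≈ T^ k v
  T^-cong zero    u≈v = u≈v
  T^-cong (suc k) u≈v = T^-cong k (T-cong u≈v)

  T^-σNorm : ∀ k u → T^ k u ≈ σNorm a k * frob (i ℕ.* k) u
  T^-σNorm zero    u = sym (trans (*-identityˡ _) (trans (frob-≡ u (ℕ.*-zeroʳ i)) (frob-zero u)))
  T^-σNorm (suc k) u = begin
    T^ k (a * frob i u)                                          ≈⟨ T^-σNorm k _ ⟩
    σNorm a k * frob (i ℕ.* k) (a * frob i u)                    ≈⟨ *-congˡ (frob-* (i ℕ.* k) _ _) ⟩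
    σNorm a k * (frob (i ℕ.* k) a * frob (i ℕ.* k) (frob i u))   ≈⟨ *-assoc _ _ _ ⟨
    σNorm a (suc k) * frob (i ℕ.* k) (frob i u)                  ≈⟨ *-congˡ (trans (frob-frob (i ℕ.* k) i u)
                                                                                   (frob-≡ u (≡.sym (ℕ.*-suc i k)))) ⟩
    σNorm a (suc k) * frob (i ℕ.* suc k) u                       ∎

  T^-InSub : ∀ k {u} → InSub (i ℕ.* k) u → T^ k u ≈ σNorm a k * u
  T^-InSub k u∈ = trans (T^-σNorm k _) (*-congˡ u∈)

  T^-semilinear : ∀ k c u d v → T^ k (c * u + d * v) ≈ frob (i ℕ.* k) c * T^ k u + frob (i ℕ.* k) d * T^ k v
  T^-semilinear k c u d v = begin
    T^ k (c * u + d * v)                       ≈⟨ T^-σNorm k _ ⟩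
    N * frob j (c * u + d * v)                 ≈⟨ *-congˡ (trans (frob-+ j _ _) (+-cong (frob-* j c u) (frob-* j d v))) ⟩
    N * (frob j c * frob j u + frob j d * frob j v)
                                               ≈⟨ solve 5 (λ N c u d v → N :* (c :* u :+ d :* v)
                                                                      := c :* (N :* u) :+ d :* (N :* v)) refl N _ _ _ _ ⟩
    frob j c * (N * frob j u) + frob j d * (N * frob j v)
                                               ≈⟨ +-cong (*-congˡ (T^-σNorm k u)) (*-congˡ (T^-σNorm k v)) ⟨
    frob j c * T^ k u + frob j d * T^ k v      ∎
    where
    N : Carrier
    N = σNorm a k
    j : ℕ
    j = i ℕ.* k

  T^-scal : ∀ k c u → T^ k (c * u) ≈ frob (i ℕ.* k) c * T^ k u
  T^-scal k c u = begin
    T^ k (c * u)                                  ≈⟨ T^-σNorm k _ ⟩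
    σNorm a k * frob (i ℕ.* k) (c * u)            ≈⟨ *-congˡ (frob-* (i ℕ.* k) c u) ⟩
    σNorm a k * (frob (i ℕ.* k) c * frob (i ℕ.* k) u) ≈⟨ x∙yz≈y∙xz _ _ _ ⟩
    frob (i ℕ.* k) c * (σNorm a k * frob (i ℕ.* k) u) ≈⟨ *-congˡ (T^-σNorm k u) ⟨
    frob (i ℕ.* k) c * T^ k u                     ∎
    where open import Algebra.Properties.CommutativeSemigroup *-commutativeSemigroup using (x∙yz≈y∙xz)

  T-semilinear : ∀ c u d v → T (c * u + d * v) ≈ frob i c * T u + frob i d * T v
  T-semilinear c u d v = trans (T^-semilinear 1 c u d v)
    (+-cong (*-congʳ (frob-≡ c (ℕ.*-identityʳ i))) (*-congʳ (frob-≡ d (ℕ.*-identityʳ i))))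

  T-scal : ∀ c u → T (c * u) ≈ frob i c * T u
  T-scal c u = trans (T^-scal 1 c u) (*-congʳ (frob-≡ c (ℕ.*-identityʳ i)))

  T-- : ∀ x y → T (x - y) ≈ T x - T y
  T-- x y = trans (*-congˡ (frob-- i x y)) (x[y-z]≈xy-xz a _ _)

  two-step-recurrence : ∀ {x y α β γ ρ} → frob i α ≉ 0# → y ≈ α * T x + β * x → T y ≈ γ * T x + ρ * x →
                        T (T x) ≈ ((γ - frob i β) * (frob i α) ⁻¹) * T x + (ρ * (frob i α) ⁻¹) * x
  two-step-recurrence {x} {y} {α} {β} {γ} {ρ} α′≉0 y≈ Ty≈ = begin
    T (T x)                                       ≈⟨ x*y≈z⇒y≈x⁻¹*z α′≉0 α′T²x≈ ⟩
    α′ ⁻¹ * ((γ - β′) * T x + ρ * x)              ≈⟨ solve 6 (λ α″ γ β′ r t x′ → α″ :* ((γ :- β′) :* t :+ r :* x′)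
                                                        := ((γ :- β′) :* α″) :* t :+ (r :* α″) :* x′) refl _ _ _ _ _ _ ⟩
    ((γ - β′) * α′ ⁻¹) * T x + (ρ * α′ ⁻¹) * x    ∎
    where
    α′ β′ : Carrier
    α′ = frob i α
    β′ = frob i β
    α′T²x≈ : α′ * T (T x) ≈ (γ - β′) * T x + ρ * x
    α′T²x≈ = begin
      α′ * T (T x)                          ≈⟨ solve 3 (λ u b t → u := (u :+ b :* t) :- b :* t) refl _ β′ (T x) ⟩
      (α′ * T (T x) + β′ * T x) - β′ * T x  ≈⟨ +-congʳ (trans (sym (T-semilinear α (T x) β x)) (T-cong (sym y≈))) ⟩
      T y - β′ * T x                        ≈⟨ +-congʳ Ty≈ ⟩
      (γ * T x + ρ * x) - β′ * T x          ≈⟨ solve 5 (λ γ β′ ρ t x′ → (γ :* t :+ ρ :* x′) :- β′ :* t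
                                                                 := (γ :- β′) :* t :+ ρ :* x′) refl γ β′ ρ (T x) x ⟩
      (γ - β′) * T x + ρ * x                ∎

  σNorm∈𝔽q : ∀ {m b} → gcd i m ≡ 1 → b ≉ 0# → InSub m b → InSub 1 (σNorm b m)
  σNorm∈𝔽q {m} gcd≡1 b≉0 b∈ = InSub-≡ gcd≡1
    (InSub-gcd i m (σNorm-fixed-by-σ m b≉0 (InSub-*ℕ i m b∈)) (InSub-σNorm m m b∈))

  module _ (a≉0 : a ≉ 0#) where

    T-≉0 : ∀ {x} → x ≉ 0# → T x ≉ 0#
    T-≉0 x≉0 = *-≉0 a≉0 (frob-≉0 i x≉0)

    module _ {n} (a∈ : InSub (3 ℕ.* n) a) (gcd[i,n]≡1 : gcd i n ≡ 1) (gcd[i,3n]≡1 : gcd i (3 ℕ.* n) ≡ 1) where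

      A : Carrier
      A = σNorm a (3 ℕ.* n)

      A∈𝔽q : InSub 1 A
      A∈𝔽q = σNorm∈𝔽q gcd[i,3n]≡1 a≉0 a∈

      T^3n≈A* : ∀ {u} → InSub (3 ℕ.* n) u → T^ (3 ℕ.* n) u ≈ A * u
      T^3n≈A* u∈ = T^-InSub (3 ℕ.* n) (InSub-*ℕ i (3 ℕ.* n) u∈)

      eigenvector⇒CubeOf𝔽qUnit : ∀ {x κ} → InSub (3 ℕ.* n) x → x ≉ 0# → InSub n κ → T x ≈ κ * x → CubeOf𝔽qUnit A
      eigenvector⇒CubeOf𝔽qUnit {x} {κ} x∈ x≉0 κ∈ Tx≈κx =
        σNorm κ n , σNorm∈𝔽q gcd[i,n]≡1 κ≉0 κ∈ , σNorm-≉0 n κ≉0 ,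
        trans (*-cancelʳ x≉0 (trans (sym (T^3n≈A* x∈)) (T^-eigen (3 ℕ.* n)))) (σNorm-*ℕ {n} κ∈ 3)
        where
        κ≉0 : κ ≉ 0#
        κ≉0 κ≈0 = T-≉0 x≉0 (trans Tx≈κx (trans (*-congʳ κ≈0) (zeroˡ x)))
        T^-eigen : ∀ k → T^ k x ≈ σNorm κ k * x
        T^-eigen zero    = sym (*-identityˡ x)
        T^-eigen (suc k) = begin
          T^ k (T x)                         ≈⟨ T^-cong k Tx≈κx ⟩
          T^ k (κ * x)                       ≈⟨ T^-scal k κ x ⟩
          frob (i ℕ.* k) κ * T^ k x          ≈⟨ *-congˡ (T^-eigen k) ⟩
          frob (i ℕ.* k) κ * (σNorm κ k * x) ≈⟨ solve 3 (λ u v w → u :* (v :* w) := (v :* u) :* w) refl _ _ _ ⟩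
          σNorm κ (suc k) * x                ∎

      module _ {x P R} (x∈ : InSub (3 ℕ.* n) x) (P∈ : InSub n P) (R∈ : InSub n R)
        (recurrence : T (T x) ≈ P * T x + R * x)
        (independent : ∀ {c d} → InSub n c → InSub n d → c * x + d * T x ≈ 0# → c ≈ 0# × d ≈ 0#) where

        coefficients-unique : ∀ {c d c′ d′} → InSub n c → InSub n d → InSub n c′ → InSub n d′ →
                              c * x + d * T x ≈ c′ * x + d′ * T x → c ≈ c′ × d ≈ d′
        coefficients-unique c∈ d∈ c′∈ d′∈ eq with independent (InSub-- n c∈ c′∈) (InSub-- n d∈ d′∈) (begin
          (_ - _) * x + (_ - _) * T x  ≈⟨ solve 6 (λ c d c′ d′ x y → (c :- c′) :* x :+ (d :- d′) :* y
                                              := (c :* x :+ d :* y) :- (c′ :* x :+ d′ :* y)) refl _ _ _ _ x (T x) ⟩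
          _ - _                        ≈⟨ x≈y⇒x∙y⁻¹≈ε eq ⟩
          0#                           ∎)
        ... | c-c′≈0 , d-d′≈0 = x∙y⁻¹≈ε⇒x≈y _ _ c-c′≈0 , x∙y⁻¹≈ε⇒x≈y _ _ d-d′≈0

        recurrenceSolution : Carrier → Carrier → ℕ → Carrier
        recurrenceSolution u₀ u₁ zero          = u₀
        recurrenceSolution u₀ u₁ (suc zero)    = u₁
        recurrenceSolution u₀ u₁ (suc (suc k)) =
          frob (i ℕ.* k) P * recurrenceSolution u₀ u₁ (suc k) + frob (i ℕ.* k) R * recurrenceSolution u₀ u₁ k

        InSub-recurrenceSolution : ∀ {u₀ u₁} → InSub n u₀ → InSub n u₁ → ∀ k → InSub n (recurrenceSolution u₀ u₁ k)
        InSub-recurrenceSolution u₀∈ u₁∈ zero          = u₀∈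
        InSub-recurrenceSolution u₀∈ u₁∈ (suc zero)    = u₁∈
        InSub-recurrenceSolution u₀∈ u₁∈ (suc (suc k)) =
          InSub-+ n (InSub-* n (InSub-frob n (i ℕ.* k) P∈) (InSub-recurrenceSolution u₀∈ u₁∈ (suc k)))
                    (InSub-* n (InSub-frob n (i ℕ.* k) R∈) (InSub-recurrenceSolution u₀∈ u₁∈ k))

        e g : ℕ → Carrier
        e = recurrenceSolution 1# 0#
        g = recurrenceSolution 0# 1#

        e∈ : ∀ k → InSub n (e k)
        e∈ = InSub-recurrenceSolution (InSub-1# n) (InSub-0# n)

        g∈ : ∀ k → InSub n (g k)
        g∈ = InSub-recurrenceSolution (InSub-0# n) (InSub-1# n)

        T^-expansion : ∀ k → T^ k x ≈ e k * x + g k * T x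
        T^-expansion zero          = sym (trans (+-cong (*-identityˡ x) (zeroˡ _)) (+-identityʳ x))
        T^-expansion (suc zero)    = sym (trans (+-cong (zeroˡ x) (*-identityˡ _)) (+-identityˡ _))
        T^-expansion (suc (suc k)) = begin
          T^ k (T (T x))                                              ≈⟨ T^-cong k recurrence ⟩
          T^ k (P * T x + R * x)                                      ≈⟨ T^-semilinear k P (T x) R x ⟩
          P′ * T^ (suc k) x + R′ * T^ k x                             ≈⟨ +-cong (*-congˡ (T^-expansion (suc k))) (*-congˡ (T^-expansion k)) ⟩
          P′ * (e (suc k) * x + g (suc k) * T x) + R′ * (e k * x + g k * T x)
            ≈⟨ solve 8 (λ p r e₁ g₁ e₀ g₀ x y → p :* (e₁ :* x :+ g₁ :* y) :+ r :* (e₀ :* x :+ g₀ :* y)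
                                              := (p :* e₁ :+ r :* e₀) :* x :+ (p :* g₁ :+ r :* g₀) :* y) refl _ _ _ _ _ _ _ _ ⟩
          e (suc (suc k)) * x + g (suc (suc k)) * T x                 ∎
          where
          P′ R′ : Carrier
          P′ = frob (i ℕ.* k) P
          R′ = frob (i ℕ.* k) R

        casoratian : ∀ k → e k * g (suc k) - e (suc k) * g k ≈ σNorm (- R) k
        casoratian zero    = begin
          1# * 1# - 0# * 0#  ≈⟨ +-cong (*-identityˡ _) (-‿cong (zeroˡ _)) ⟩
          1# - 0#            ≈⟨ +-congˡ -0#≈0# ⟩
          1# + 0#            ≈⟨ +-identityʳ _ ⟩
          1#                 ∎
        casoratian (suc k) = begin
          e (suc k) * g (suc (suc k)) - e (suc (suc k)) * g (suc k)
            ≈⟨ solve 6 (λ p r e₀ e₁ g₀ g₁ → e₁ :* (p :* g₁ :+ r :* g₀) :- (p :* e₁ :+ r :* e₀) :* g₁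
                                          := (:- r) :* (e₀ :* g₁ :- e₁ :* g₀)) refl _ _ _ _ _ _ ⟩
          (- frob (i ℕ.* k) R) * (e k * g (suc k) - e (suc k) * g k)
            ≈⟨ *-cong (sym (frob-‿ (i ℕ.* k) R)) (casoratian k) ⟩
          frob (i ℕ.* k) (- R) * σNorm (- R) k
            ≈⟨ *-comm _ _ ⟩
          σNorm (- R) (suc k) ∎

        A²≈σNorm[-R]³ : A * A ≈ σNorm (- R) n ^ 3
        A²≈σNorm[-R]³ = begin
          A * A                                                    ≈⟨ +-identityʳ _ ⟨
          A * A + 0#                                               ≈⟨ +-congˡ (trans (-‿cong (zeroˡ _)) -0#≈0#) ⟨
          A * A - 0# * g 3n                                        ≈⟨ +-cong (*-cong (proj₁ e,g[3n]≈A,0) (proj₂ e,g[1+3n]≈0,A))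
                                                                             (-‿cong (*-congʳ (proj₁ e,g[1+3n]≈0,A))) ⟨
          e 3n * g (suc 3n) - e (suc 3n) * g 3n                    ≈⟨ casoratian 3n ⟩
          σNorm (- R) 3n                                           ≈⟨ σNorm-*ℕ {n} (InSub-‿ n R∈) 3 ⟩
          σNorm (- R) n ^ 3                                        ∎
          where
          3n : ℕ
          3n = 3 ℕ.* n
          A∈ : InSub n A
          A∈ = InSub-1⇒InSub n A∈𝔽q
          +0* : ∀ u v → u ≈ u + 0# * v
          +0* u v = sym (trans (+-congˡ (zeroˡ v)) (+-identityʳ u))
          0*+ : ∀ u v → v ≈ 0# * u + v
          0*+ u v = sym (trans (+-congʳ (zeroˡ u)) (+-identityˡ v))
          e,g[3n]≈A,0 : e 3n ≈ A × g 3n ≈ 0#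
          e,g[3n]≈A,0 = coefficients-unique (e∈ 3n) (g∈ 3n) A∈ (InSub-0# n) (begin
            e 3n * x + g 3n * T x  ≈⟨ T^-expansion 3n ⟨
            T^ 3n x                ≈⟨ T^3n≈A* x∈ ⟩
            A * x                  ≈⟨ +0* (A * x) (T x) ⟩
            A * x + 0# * T x       ∎)
          e,g[1+3n]≈0,A : e (suc 3n) ≈ 0# × g (suc 3n) ≈ A
          e,g[1+3n]≈0,A = coefficients-unique (e∈ (suc 3n)) (g∈ (suc 3n)) (InSub-0# n) A∈ (begin
            e (suc 3n) * x + g (suc 3n) * T x  ≈⟨ T^-expansion (suc 3n) ⟨
            T^ 3n (T x)                        ≈⟨ T^3n≈A* (InSub-* 3n a∈ (InSub-frob 3n i x∈)) ⟩
            A * T x                            ≈⟨ 0*+ x (A * T x) ⟩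
            0# * x + A * T x                   ∎)

      non-eigenvector⇒independent : ∀ {x} → x ≉ 0# → ¬ InSub n (T x * x ⁻¹) →
        ∀ {c d} → InSub n c → InSub n d → c * x + d * T x ≈ 0# → c ≈ 0# × d ≈ 0#
      non-eigenvector⇒independent {x} x≉0 κ∉ {c} {d} c∈ d∈ cx+dTx≈0 = c≈0 , d≈0
        where
        d≈0 : d ≈ 0#
        d≈0 with d ≟ 0#
        ... | yes d≈0 = d≈0
        ... | no  d≉0 = ⊥-elim (κ∉ (InSub-cong n (sym κ≈-c/d) (InSub-‿ n (InSub-* n c∈ (InSub-⁻¹ n d∈)))))
          where
          κ≈-c/d : T x * x ⁻¹ ≈ - (c * d ⁻¹)
          κ≈-c/d = begin
            T x * x ⁻¹                      ≈⟨ *-congʳ (x*y≈z⇒y≈x⁻¹*z d≉0 (inverseʳ-unique (c * x) (d * T x) cx+dTx≈0)) ⟩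
            d ⁻¹ * - (c * x) * x ⁻¹         ≈⟨ solve 4 (λ d′ c x x′ → d′ :* (:- (c :* x)) :* x′
                                                            := (:- (c :* d′)) :* (x :* x′)) refl _ _ _ _ ⟩
            - (c * d ⁻¹) * (x * x ⁻¹)       ≈⟨ *-congˡ (⁻¹-inverseʳ x≉0) ⟩
            - (c * d ⁻¹) * 1#               ≈⟨ *-identityʳ _ ⟩
            - (c * d ⁻¹)                    ∎
        c≈0 : c ≈ 0#
        c≈0 = x*y≈0⇒y≈0 x≉0 (begin
          x * c              ≈⟨ *-comm x c ⟩
          c * x              ≈⟨ +-identityʳ _ ⟨
          c * x + 0#         ≈⟨ +-congˡ (trans (*-congʳ d≈0) (zeroˡ _)) ⟨
          c * x + d * T x    ≈⟨ cx+dTx≈0 ⟩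
          0#                 ∎)

      recurrence⇒CubeOf𝔽qUnit : ∀ {x P R} → InSub (3 ℕ.* n) x → x ≉ 0# → InSub n P → InSub n R → R ≉ 0# →
                                T (T x) ≈ P * T x + R * x → CubeOf𝔽qUnit A
      recurrence⇒CubeOf𝔽qUnit {x} {P} {R} x∈ x≉0 P∈ R∈ R≉0 recurrence = by-cases (frob n κ ≟ κ)
        where
        κ : Carrier
        κ = T x * x ⁻¹
        -R≉0 : - R ≉ 0#
        -R≉0 = -‿≉0 R≉0
        by-cases : Dec (InSub n κ) → CubeOf𝔽qUnit A
        by-cases (yes κ∈) = eigenvector⇒CubeOf𝔽qUnit x∈ x≉0 κ∈
          (sym (trans (*-assoc _ _ _) (trans (*-congˡ (⁻¹-inverseˡ x≉0)) (*-identityʳ _))))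
        by-cases (no  κ∉) = square≈cube⇒CubeOf𝔽qUnit A∈𝔽q (σNorm-≉0 (3 ℕ.* n) a≉0)
          (σNorm∈𝔽q gcd[i,n]≡1 -R≉0 (InSub-‿ n R∈)) (σNorm-≉0 n -R≉0)
          (A²≈σNorm[-R]³ x∈ P∈ R∈ recurrence (non-eigenvector⇒independent x≉0 κ∉))

  σNorm≈Norm : ∀ {N b} .{{_ : NonZero N}} → gcd i N ≡ 1 → InSub N b → σNorm b N ≈ Norm N b
  σNorm≈Norm {N} {b} gcd≡1 b∈ = begin
    σNorm b N                       ≈⟨ ∏<-permute (*%-permutation i gcd≡1) (λ j → trans (frob-≡ b (toℕ-*% i j)) (frob-% b∈ _)) ⟨
    ∏< N (λ j → frob j b)           ≈⟨ Norm≈∏< N ⟨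
    Norm N b                        ∎
    where
    open MultiplicationModulo N using (*%-permutation; toℕ-*%)
    Norm≈∏< : ∀ k → Norm k b ≈ ∏< k (λ j → frob j b)
    Norm≈∏< zero    = refl
    Norm≈∏< (suc k) = *-congʳ (Norm≈∏< k)

module Scattering {c ℓ} (F : CommutativeRing c ℓ) (isField : IsField F)
  (_≟_ : ∀ x y → Dec (CommutativeRing._≈_ F x y)) (q : ℕ) .{{_ : NonZero q}}
  (q-additive : PrimeCharacteristic.Additive (CommutativeRing.commutativeSemiring F) q)
  (n : ℕ) .{{_ : NonZero n}} (i : ℕ) (ω a : CommutativeRing.Carrier F)
  (ω∈ : FieldNotions.InSub F q (2 ℕ.* n) ω) (ω∉ : ¬ FieldNotions.InSub F q n ω)
  (a∈ : FieldNotions.InSub F q (3 ℕ.* n) a) (a≉0 : ¬ CommutativeRing._≈_ F a (CommutativeRing.0# F))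
  (gcd[i,2n]≡1 : gcd i (2 ℕ.* n) ≡ 1) (gcd[i,3n]≡1 : gcd i (3 ℕ.* n) ≡ 1) where
  open CommutativeRing F
  open FieldNotions F q
  open Field F isField _≟_
  open Frobenius F isField _≟_ q q-additive
  open SemilinearMap F isField _≟_ q q-additive i a
  open IntegerCoefficientRingSolver F using (solve; _:+_; _:*_; _:-_; :-_; _:=_)
  open import Algebra.Properties.Group +-group
    using (x∙y⁻¹≈ε⇒x≈y; x≈y⇒x∙y⁻¹≈ε; inverseʳ-unique) renaming (∙-cancelʳ to +-cancelʳ)
  open import Algebra.Properties.Ring ring using (-‿distribˡ-*)
  open import Relation.Binary.Reasoning.Setoid setoid

  gcd[i,n]≡1 : gcd i n ≡ 1
  gcd[i,n]≡1 = gcd[m,kn]≡1⇒gcd[m,n]≡1 i 2 n gcd[i,2n]≡1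

  f : Carrier → Carrier
  f x = T x + x * ω

  ω∉𝔽q³ⁿ : ¬ InSub (3 ℕ.* n) ω
  ω∉𝔽q³ⁿ ω∈𝔽q³ⁿ = ω∉ (InSub-∸ℕ n (2 ℕ.* n) ω∈𝔽q³ⁿ ω∈)

  f-injective : ∀ x y → InSub (3 ℕ.* n) x → InSub (3 ℕ.* n) y → f x ≈ f y → x ≈ y
  f-injective x y x∈ y∈ fx≈fy with (x - y) ≟ 0#
  ... | yes x-y≈0 = x∙y⁻¹≈ε⇒x≈y x y x-y≈0
  ... | no  x-y≉0 = ⊥-elim (ω∉𝔽q³ⁿ (InSub-cong (3 ℕ.* n) (sym ω≈) z⁻¹*-Tz∈))
    where
    z : Carrier
    z = x - y
    z∈ : InSub (3 ℕ.* n) z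
    z∈ = InSub-- (3 ℕ.* n) x∈ y∈
    z⁻¹*-Tz∈ : InSub (3 ℕ.* n) (z ⁻¹ * - T z)
    z⁻¹*-Tz∈ = InSub-* (3 ℕ.* n) (InSub-⁻¹ (3 ℕ.* n) z∈)
                        (InSub-‿ (3 ℕ.* n) (InSub-* (3 ℕ.* n) a∈ (InSub-frob (3 ℕ.* n) i z∈)))
    ω≈ : ω ≈ z ⁻¹ * - T z
    ω≈ = x*y≈z⇒y≈x⁻¹*z x-y≉0 (inverseʳ-unique (T z) (z * ω) (begin
      T z + z * ω                  ≈⟨ +-congʳ (T-- x y) ⟩
      (T x - T y) + (x - y) * ω    ≈⟨ solve 5 (λ u v x y w → (u :- v) :+ (x :- y) :* w := (u :+ x :* w) :- (v :+ y :* w)) refl _ _ x y ω ⟩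
      f x - f y                    ≈⟨ x≈y⇒x∙y⁻¹≈ε fx≈fy ⟩
      0#                           ∎))

  frob-3n≈frob-n : ∀ {u} → InSub (2 ℕ.* n) u → frob (3 ℕ.* n) u ≈ frob n u
  frob-3n≈frob-n {u} u∈ = begin
    frob (n ℕ.+ 2 ℕ.* n) u    ≈⟨ frob-≡ u (ℕ.+-comm n (2 ℕ.* n)) ⟩
    frob (2 ℕ.* n ℕ.+ n) u    ≈⟨ frob-frob n (2 ℕ.* n) u ⟨
    frob n (frob (2 ℕ.* n) u) ≈⟨ frob-cong n u∈ ⟩
    frob n u                  ∎

  frob-n-involutive : ∀ {u} → InSub (2 ℕ.* n) u → frob n (frob n u) ≈ u
  frob-n-involutive {u} u∈ = trans (frob-frob n n u) (InSub-≡ (≡.cong (n ℕ.+_) (ℕ.+-identityʳ n)) u∈)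

  Skew : Carrier → Set ℓ
  Skew u = frob n u ≈ - u

  Skew-cong : ∀ {u v} → u ≈ v → Skew u → Skew v
  Skew-cong u≈v ū≈-u = trans (frob-cong n (sym u≈v)) (trans ū≈-u (-‿cong u≈v))

  Skew-‿ : ∀ {u} → Skew u → Skew (- u)
  Skew-‿ ū≈-u = trans (frob-‿ n _) (-‿cong ū≈-u)

  Skew-* : ∀ {u v} → Skew u → InSub n v → Skew (u * v)
  Skew-* {u} {v} ū≈-u v∈ = begin
    frob n (u * v)       ≈⟨ frob-* n u v ⟩
    frob n u * frob n v  ≈⟨ *-cong ū≈-u v∈ ⟩
    - u * v              ≈⟨ -‿distribˡ-* u v ⟨
    - (u * v)            ∎

  Skew-conj-diff : ∀ {u} → InSub (2 ℕ.* n) u → Skew (u - frob n u)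
  Skew-conj-diff {u} u∈ = begin
    frob n (u - frob n u)          ≈⟨ frob-- n u (frob n u) ⟩
    frob n u - frob n (frob n u)   ≈⟨ +-congˡ (-‿cong (frob-n-involutive u∈)) ⟩
    frob n u - u                   ≈⟨ solve 2 (λ u v → v :- u := :- (u :- v)) refl u (frob n u) ⟩
    - (u - frob n u)               ∎

  Skew/Skew∈𝔽qⁿ : ∀ {u v} → Skew u → Skew v → v ≉ 0# → InSub n (u * v ⁻¹)
  Skew/Skew∈𝔽qⁿ {u} {v} ū≈-u v̄≈-v v≉0 = begin
    frob n (u * v ⁻¹)        ≈⟨ frob-* n u (v ⁻¹) ⟩
    frob n u * frob n (v ⁻¹) ≈⟨ *-congˡ (frob-⁻¹ n v) ⟩
    frob n u * frob n v ⁻¹   ≈⟨ *-cong ū≈-u (trans (⁻¹-cong v̄≈-v) (⁻¹-‿ v≉0)) ⟩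
    - u * - (v ⁻¹)           ≈⟨ solve 2 (λ u w → (:- u) :* (:- w) := u :* w) refl u (v ⁻¹) ⟩
    u * v ⁻¹                 ∎

  ω̄ δ : Carrier
  ω̄ = frob n ω
  δ = ω - ω̄

  δ≉0 : δ ≉ 0#
  δ≉0 δ≈0 = ω∉ (sym (x∙y⁻¹≈ε⇒x≈y ω ω̄ δ≈0))

  Skew-δ : Skew δ
  Skew-δ = Skew-conj-diff ω∈

  ω≉0 : ω ≉ 0#
  ω≉0 ω≈0 = ω∉ (InSub-cong n (sym ω≈0) (InSub-0# n))

  ω̄≉0 : ω̄ ≉ 0#
  ω̄≉0 = frob-≉0 n ω≉0

  ωω̄∈𝔽qⁿ : InSub n (ω * ω̄)
  ωω̄∈𝔽qⁿ = trans (frob-* n ω ω̄) (trans (*-congˡ (frob-n-involutive ω∈)) (*-comm _ _))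

  frob-3n-f : ∀ {u} → InSub (3 ℕ.* n) u → frob (3 ℕ.* n) (f u) ≈ T u + u * ω̄
  frob-3n-f {u} u∈ = trans (frob-+ (3 ℕ.* n) _ _)
    (+-cong (trans (frob-* (3 ℕ.* n) _ _) (*-cong a∈ (InSub-frob (3 ℕ.* n) i u∈)))
            (trans (frob-* (3 ℕ.* n) _ _) (*-cong u∈ (frob-3n≈frob-n ω∈))))

  eliminate-y : ∀ {t y t′ x l l̄ w w̄} → t + y * w ≈ l * (t′ + x * w) → t + y * w̄ ≈ l̄ * (t′ + x * w̄) →
                (w - w̄) * y ≈ (l - l̄) * t′ + (l * w - l̄ * w̄) * x
  eliminate-y {t} {y} {t′} {x} {l} {l̄} {w} {w̄} eq eq̄ = begin
    (w - w̄) * y                              ≈⟨ solve 4 (λ t y w w̄ → (w :- w̄) :* y := (t :+ y :* w) :- (t :+ y :* w̄)) refl t y w w̄ ⟩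
    (t + y * w) - (t + y * w̄)                ≈⟨ +-cong eq (-‿cong eq̄) ⟩
    l * (t′ + x * w) - l̄ * (t′ + x * w̄)      ≈⟨ solve 6 (λ t′ x l l̄ w w̄ → l :* (t′ :+ x :* w) :- l̄ :* (t′ :+ x :* w̄)
                                                    := (l :- l̄) :* t′ :+ (l :* w :- l̄ :* w̄) :* x) refl t′ x l l̄ w w̄ ⟩
    (l - l̄) * t′ + (l * w - l̄ * w̄) * x       ∎

  eliminate-t : ∀ {t y t′ x l l̄ w w̄} → t + y * w ≈ l * (t′ + x * w) → t + y * w̄ ≈ l̄ * (t′ + x * w̄) →
                (w - w̄) * t ≈ (l̄ * w - l * w̄) * t′ + (- ((l - l̄) * (w * w̄))) * x
  eliminate-t {t} {y} {t′} {x} {l} {l̄} {w} {w̄} eq eq̄ = begin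
    (w - w̄) * t                                   ≈⟨ solve 4 (λ t y w w̄ → (w :- w̄) :* t := w :* (t :+ y :* w̄) :- w̄ :* (t :+ y :* w)) refl t y w w̄ ⟩
    w * (t + y * w̄) - w̄ * (t + y * w)             ≈⟨ +-cong (*-congˡ eq̄) (-‿cong (*-congˡ eq)) ⟩
    w * (l̄ * (t′ + x * w̄)) - w̄ * (l * (t′ + x * w)) ≈⟨ solve 6 (λ t′ x l l̄ w w̄ → w :* (l̄ :* (t′ :+ x :* w̄)) :- w̄ :* (l :* (t′ :+ x :* w))
                                                         := (l̄ :* w :- l :* w̄) :* t′ :+ (:- ((l :- l̄) :* (w :* w̄))) :* x) refl t′ x l l̄ w w̄ ⟩
    (l̄ * w - l * w̄) * t′ + (- ((l - l̄) * (w * w̄))) * x ∎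

  module Proportional {x y l} (x∈ : InSub (3 ℕ.* n) x) (y∈ : InSub (3 ℕ.* n) y) (l∈ : InSub (2 ℕ.* n) l)
    (fx≉0 : f x ≉ 0#) (fy≈lfx : f y ≈ l * f x) where

    l̄ : Carrier
    l̄ = frob n l

    x≉0 : x ≉ 0#
    x≉0 x≈0 = fx≉0 (begin
      T x + x * ω    ≈⟨ +-cong (T-cong x≈0) (*-congʳ x≈0) ⟩
      T 0# + 0# * ω  ≈⟨ +-cong (trans (*-congˡ (frob-0# i)) (zeroʳ a)) (zeroˡ ω) ⟩
      0# + 0#        ≈⟨ +-identityʳ 0# ⟩
      0#             ∎)

    fȳ≈l̄fx̄ : T y + y * ω̄ ≈ l̄ * (T x + x * ω̄)
    fȳ≈l̄fx̄ = begin
      T y + y * ω̄                             ≈⟨ frob-3n-f y∈ ⟨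
      frob (3 ℕ.* n) (f y)                     ≈⟨ frob-cong (3 ℕ.* n) fy≈lfx ⟩
      frob (3 ℕ.* n) (l * f x)                 ≈⟨ frob-* (3 ℕ.* n) l (f x) ⟩
      frob (3 ℕ.* n) l * frob (3 ℕ.* n) (f x)  ≈⟨ *-cong (frob-3n≈frob-n l∈) (frob-3n-f x∈) ⟩
      l̄ * (T x + x * ω̄)                        ∎

    δy≈ : δ * y ≈ (l - l̄) * T x + (l * ω - l̄ * ω̄) * x
    δy≈ = eliminate-y fy≈lfx fȳ≈l̄fx̄

    l∈𝔽qⁿ⇒l∈𝔽q : InSub n l → InSub 1 l
    l∈𝔽qⁿ⇒l∈𝔽q l̄≈l = InSub-≡ gcd[i,n]≡1 (InSub-gcd i n l∈𝔽qⁱ l̄≈l)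
      where
      y≈lx : y ≈ l * x
      y≈lx = *-cancelˡ δ≉0 (begin
        δ * y                                   ≈⟨ δy≈ ⟩
        (l - l̄) * T x + (l * ω - l̄ * ω̄) * x    ≈⟨ +-cong (*-congʳ (+-congˡ (-‿cong l̄≈l))) (*-congʳ (+-congˡ (-‿cong (*-congʳ l̄≈l)))) ⟩
        (l - l) * T x + (l * ω - l * ω̄) * x     ≈⟨ solve 5 (λ l t x w w̄ → (l :- l) :* t :+ (l :* w :- l :* w̄) :* x
                                                              := (w :- w̄) :* (l :* x)) refl l (T x) x ω ω̄ ⟩
        δ * (l * x)                             ∎)
      Ty≈lTx : T y ≈ l * T x
      Ty≈lTx = +-cancelʳ (y * ω) (T y) (l * T x) (begin
        T y + y * ω            ≈⟨ fy≈lfx ⟩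
        l * (T x + x * ω)      ≈⟨ solve 4 (λ l t x w → l :* (t :+ x :* w) := l :* t :+ (l :* x) :* w) refl l (T x) x ω ⟩
        l * T x + (l * x) * ω  ≈⟨ +-congˡ (*-congʳ y≈lx) ⟨
        l * T x + y * ω        ∎)
      l∈𝔽qⁱ : InSub i l
      l∈𝔽qⁱ = *-cancelʳ (T-≉0 a≉0 x≉0) (begin
        frob i l * T x   ≈⟨ T-scal l x ⟨
        T (l * x)        ≈⟨ T-cong y≈lx ⟨
        T y              ≈⟨ Ty≈lTx ⟩
        l * T x          ∎)

    α β γ ρ : Carrier
    α = (l - l̄) * δ ⁻¹
    β = (l * ω - l̄ * ω̄) * δ ⁻¹
    γ = (l̄ * ω - l * ω̄) * δ ⁻¹
    ρ = (- ((l - l̄) * (ω * ω̄))) * δ ⁻¹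

    α∈ : InSub n α
    α∈ = Skew/Skew∈𝔽qⁿ (Skew-conj-diff l∈) Skew-δ δ≉0

    β∈ : InSub n β
    β∈ = Skew/Skew∈𝔽qⁿ (Skew-cong (+-congˡ (-‿cong (frob-* n l ω))) (Skew-conj-diff (InSub-* (2 ℕ.* n) l∈ ω∈))) Skew-δ δ≉0

    γ∈ : InSub n γ
    γ∈ = Skew/Skew∈𝔽qⁿ (Skew-cong (+-congˡ (-‿cong l̄ω̄≈lω̄))
                                  (Skew-conj-diff (InSub-* (2 ℕ.* n) (InSub-frob (2 ℕ.* n) n l∈) ω∈)))
                       Skew-δ δ≉0
      where
      l̄ω̄≈lω̄ : frob n (l̄ * ω) ≈ l * ω̄
      l̄ω̄≈lω̄ = trans (frob-* n l̄ ω) (*-congʳ (frob-n-involutive l∈))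

    ρ∈ : InSub n ρ
    ρ∈ = Skew/Skew∈𝔽qⁿ (Skew-‿ (Skew-* (Skew-conj-diff l∈) ωω̄∈𝔽qⁿ)) Skew-δ δ≉0

    divide-by-δ : ∀ {z u v t s} → δ * z ≈ u * t + v * s → z ≈ (u * δ ⁻¹) * t + (v * δ ⁻¹) * s
    divide-by-δ {z} {u} {v} {t} {s} δz≈ = trans (x*y≈z⇒y≈x⁻¹*z δ≉0 δz≈)
      (solve 5 (λ d u v t s → d :* (u :* t :+ v :* s) := (u :* d) :* t :+ (v :* d) :* s) refl (δ ⁻¹) u v t s)

    l∉𝔽qⁿ⇒Norm-cube : ¬ InSub n l → CubeOf𝔽qUnit (Norm (3 ℕ.* n) a)
    l∉𝔽qⁿ⇒Norm-cube l∉ = CubeOf𝔽qUnit-cong (σNorm≈Norm gcd[i,3n]≡1 a∈)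
      (recurrence⇒CubeOf𝔽qUnit a≉0 a∈ gcd[i,n]≡1 gcd[i,3n]≡1 x∈ x≉0 P∈ R∈ R≉0
        (two-step-recurrence α′≉0 (divide-by-δ δy≈) (divide-by-δ (eliminate-t fy≈lfx fȳ≈l̄fx̄))))
      where
      instance
        3n≢0 : NonZero (3 ℕ.* n)
        3n≢0 = ℕ.m*n≢0 3 n
      l-l̄≉0 : l - l̄ ≉ 0#
      l-l̄≉0 l-l̄≈0 = l∉ (sym (x∙y⁻¹≈ε⇒x≈y l l̄ l-l̄≈0))
      α′≉0 : frob i α ≉ 0#
      α′≉0 = frob-≉0 i (*-≉0 l-l̄≉0 (⁻¹-≉0 δ≉0))
      P∈ : InSub n ((γ - frob i β) * frob i α ⁻¹)
      P∈ = InSub-* n (InSub-- n γ∈ (InSub-frob n i β∈)) (InSub-⁻¹ n (InSub-frob n i α∈))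
      R∈ : InSub n (ρ * frob i α ⁻¹)
      R∈ = InSub-* n ρ∈ (InSub-⁻¹ n (InSub-frob n i α∈))
      R≉0 : ρ * frob i α ⁻¹ ≉ 0#
      R≉0 = *-≉0 (*-≉0 (-‿≉0 (*-≉0 l-l̄≉0 (*-≉0 ω≉0 ω̄≉0))) (⁻¹-≉0 δ≉0)) (⁻¹-≉0 α′≉0)

  f-scattered : ¬ CubeOf𝔽qUnit (Norm (3 ℕ.* n) a) →
                ∀ {x y l} → InSub (3 ℕ.* n) x → InSub (3 ℕ.* n) y → InSub (2 ℕ.* n) l →
                f x ≉ 0# → f y ≈ l * f x → ∃ λ μ → InSub 1 μ × f y ≈ μ * f x
  f-scattered ¬cube {x} {y} {l} x∈ y∈ l∈ fx≉0 fy≈lfx = by-cases (frob n l ≟ l)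
    where
    open Proportional x∈ y∈ l∈ fx≉0 fy≈lfx
    by-cases : Dec (InSub n l) → ∃ λ μ → InSub 1 μ × f y ≈ μ * f x
    by-cases (yes l∈𝔽qⁿ) = l , l∈𝔽qⁿ⇒l∈𝔽q l∈𝔽qⁿ , fy≈lfx
    by-cases (no  l∉𝔽qⁿ) = ⊥-elim (¬cube (l∉𝔽qⁿ⇒Norm-cube l∉𝔽qⁿ))

  U : Carrier → Set (c ⊔ ℓ)
  U u = ∃ λ x → InSub (3 ℕ.* n) x × u ≈ f x

  U-scattered : ¬ CubeOf𝔽qUnit (Norm (3 ℕ.* n) a) → Scattered (2 ℕ.* n) U
  U-scattered ¬cube v (x , x∈ , v≈fx) v≉0 w (y , y∈ , w≈fy) (l , l∈ , w≈lv)
    with f-scattered ¬cube x∈ y∈ l∈ (λ fx≈0 → v≉0 (trans v≈fx fx≈0)) (trans (sym w≈fy) (trans w≈lv (*-congˡ v≈fx)))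
  ... | μ , μ∈ , fy≈μfx = μ , μ∈ , trans w≈fy (trans fy≈μfx (*-congˡ (sym v≈fx)))

theorem2p4 : ∀ {c ℓ} (q n : ℕ) → IsPrimePower q → q % 3 ≡ 1 → 2 ≤ n →
    (F : CommutativeRing c ℓ) → IsField F → HasSize F (q ℕ.^ (6 ℕ.* n)) →
    let open CommutativeRing F
        open FieldNotions F q
    in (ω a : Carrier) (i : ℕ) →
    InSub (2 ℕ.* n) ω → ¬ InSub n ω →
    InSub (3 ℕ.* n) a → a ≉ 0# →
    1 ≤ i → i ≤ 3 ℕ.* n ∸ 1 →
    gcd i (2 ℕ.* n) ≡ 1 → gcd i (3 ℕ.* n) ≡ 1 →
    ¬ (Norm (3 ℕ.* n) a ^ ((q ∸ 1) / 3) ≈ 1#) →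
    let f = λ x → a * (x ^ (q ℕ.^ i)) + x * ω
        U = λ u → ∃ λ x → InSub (3 ℕ.* n) x × u ≈ f x
    in
    -- rank 3n: x ↦ f x is injective on F_{q^{3n}}, so dim_{F_q} U = 3n
    (∀ x y → InSub (3 ℕ.* n) x → InSub (3 ℕ.* n) y → f x ≈ f y → x ≈ y)
    -- scattered w.r.t. F_{q^{2n}}
    × Scattered (2 ℕ.* n) U
theorem2p4 q n@(suc _) q-primePower q%3≡1 _ F isField size ω a i ω∈ ω∉ a∈ a≉0 _ _ gcd[i,2n]≡1 gcd[i,3n]≡1 N[a]^[q∸1]/3≉1 =
  f-injective , U-scattered (λ N[a]-cube → N[a]^[q∸1]/3≉1 (CubeOf𝔽qUnit⇒^[q∸1]/3≈1 q%3≡1 N[a]-cube))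
  where
  instance
    q≢0 : NonZero q
    q≢0 = IsPrimePower⇒NonZero q-primePower
  open FiniteRing F size using (_≟_)
  q-additive : PrimeCharacteristic.Additive (CommutativeRing.commutativeSemiring F) q
  q-additive = ^q-additive F isField {N = 6 ℕ.* n} q-primePower size
  open Frobenius F isField _≟_ q q-additive using (CubeOf𝔽qUnit⇒^[q∸1]/3≈1)
  open Scattering F isField _≟_ q q-additive n i ω a ω∈ ω∉ a∈ a≉0 gcd[i,2n]≡1 gcd[i,3n]≡1
    using (f-injective; U-scattered)
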